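{- Let $r\ge 2$ and $s\ge 1$ be integers. Then: (1) if $s$ is even and $rs\not\equiv 0\pmod 4$, $\chi_{la}(DF^1(r,2s))=3$; (2) if $s$ is even and $r\not\equiv 0\pmod 4$, $\chi_{la}(DF^2(r,2s))=3$; (3) $\chi_{la}(DF^3(r,2s))=3$; (4) if $r$ is even, $\chi_{la}(DF^4(r,2s))=3$.
   Context: For a graph $G=(V,E)$ with $|E|=m$ and no isolated vertices, a local antimagic labeling is a bijection $f:E\to\{1,\dots,m\}$ such that $f^+(u)\ne f^+(v)$ for every edge $uv$, where $f^+(x)=\sum f(e)$ over all edges $e$ incident to $x$. The local antimagic chromatic number $\chi_{la}(G)$ is the minimum, over all local antimagic labelings $f$ of $G$, of the number of distinct values taken by $f^+$ (also for disconnected graphs). Merging a set of vertices means identifying them into a single vertex incident to all edges previously incident to any of them. Let $rDF(2s)$ be the graph with components indexed by $j=1,\dots,r$, where component $j$ consists of: paths $u^1_{j,a}w^1_{j,a}v^1_{j,a}$ and $u^2_{j,a}w^2_{j,a}v^2_{j,a}$ for $1\le a\le s$, a vertex $y_j$ adjacent to $w^1_{j,a},u^2_{j,a},v^2_{j,a}$ for all $a$, and a vertex $z_j$ adjacent to $u^1_{j,a},v^1_{j,a},w^2_{j,a}$ for all $a$ (each component is a diamond fan $DF(2s)$). Define: $DF^1(r,2s)$ is obtained from $rDF(2s)$ by merging, for each $1\le a\le s$, the vertices $\{w^1_{j,a}:1\le j\le r\}$ into one vertex and $\{w^2_{j,a}:1\le j\le r\}$ into one vertex. $DF^2(r,2s)$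 is obtained by merging, for each $1\le a\le s$, each of the four sets $\{u^1_{j,a}:1\le j\le r\}$, $\{u^2_{j,a}:1\le j\le r\}$, $\{v^1_{j,a}:1\le j\le r\}$, $\{v^2_{j,a}:1\le j\le r\}$ into one vertex. $DF^3(r,2s)$ is obtained by merging $\{y_j:1\le j\le r\}$ into one vertex $y$ and $\{z_j:1\le j\le r\}$ into one vertex $z$. For even $r$, $DF^4(r,2s)$ is obtained by merging, for each $1\le j\le r$, $y_j$ with $z_{j+1}$ (indices mod $r$, $z_{r+1}=z_1$) into a vertex of degree $6s$. -}

module Defs where

open import Data.Nat using (ℕ; zero; suc; _≤_)
import Data.Nat as ℕ
open import Data.Nat.Properties using () renaming (_≟_ to _≟ℕ_)
open import Data.Fin using (Fin; zero; suc; toℕ)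
open import Data.Fin.Properties using () renaming (_≟_ to _≟F_)
open import Data.Fin.Permutation using (Permutation′; _⟨$⟩ʳ_)
open import Data.List using (List; []; _∷_; length; map; concatMap; allFin; upTo; lookup; deduplicate)
open import Data.Product using (Σ; _×_; _,_; proj₁; proj₂)
open import Data.Bool using (Bool; if_then_else_; _∨_)
open import Data.Nat.ListAction using (sum)
open import Relation.Nullary using (¬_; Dec; yes; no; ⌊_⌋)
open import Relation.Binary.PropositionalEquality using (_≡_; _≢_; refl; cong)

-- Generic setting: a graph without isolated vertices is given by its
-- list of edges (pairs of endpoints) over a vertex type with decidable
-- equality; its vertex set is the set of endpoints of its edges.

module LocalAntimagic {V : Set} (_≟V_ : (x y : V) → Dec (x ≡ y))
                      (E : List (V × V)) where

  m : ℕ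
  m = length E

  edge : Fin m → V × V
  edge = lookup E

  -- a labeling is a bijection  f : E → {1,…,m};  edge i gets label 1 + π(i)
  Labeling : Set
  Labeling = Permutation′ m

  label : Labeling → Fin m → ℕ
  label π i = suc (toℕ (π ⟨$⟩ʳ i))

  incident : V → V × V → Bool
  incident x (u , v) = ⌊ x ≟V u ⌋ ∨ ⌊ x ≟V v ⌋

  vsum : Labeling → V → ℕ
  vsum π x = sum (map (λ i → if incident x (edge i) then label π i else 0) (allFin m))

  IsLocalAntimagic : Labeling → Set
  IsLocalAntimagic π = ∀ (i : Fin m) → vsum π (proj₁ (edge i)) ≢ vsum π (proj₂ (edge i))

  vertices : List V
  vertices = concatMap (λ e → proj₁ e ∷ proj₂ e ∷ []) E

  colours : Labeling → ℕ
  colours π = length (deduplicate _≟ℕ_ (map (vsum π) vertices))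

  ChiLa : ℕ → Set
  ChiLa k = (Σ Labeling λ π → IsLocalAntimagic π × colours π ≡ k)
          × (∀ π → IsLocalAntimagic π → k ≤ colours π)

-- Vertices of r DF(2s) (components j < r, indices a < s, 0-based):
--   p i k j a  :  superscript i ∈ {0,1} (paper: 1,2), position
--                 k = 0,1,2 for u,w,v;  i.e. p i 0 j a = u^{i+1}_{j,a} etc.
--   hub 0 j = y_j ,  hub 1 j = z_j

data DV : Set where
  p   : Fin 2 → Fin 3 → ℕ → ℕ → DV
  hub : Fin 2 → ℕ → DV

_≟DV_ : (x y : DV) → Dec (x ≡ y)
p i k j a ≟DV p i' k' j' a' with i ≟F i' | k ≟F k' | j ≟ℕ j' | a ≟ℕ a'
... | yes refl | yes refl | yes refl | yes refl = yes refl
... | no ne | _ | _ | _ = no λ { refl → ne refl }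
... | yes _ | no ne | _ | _ = no λ { refl → ne refl }
... | yes _ | yes _ | no ne | _ = no λ { refl → ne refl }
... | yes _ | yes _ | yes _ | no ne = no λ { refl → ne refl }
p _ _ _ _ ≟DV hub _ _ = no λ ()
hub _ _ ≟DV p _ _ _ _ = no λ ()
hub i j ≟DV hub i' j' with i ≟F i' | j ≟ℕ j'
... | yes refl | yes refl = yes refl
... | no ne | _ = no λ { refl → ne refl }
... | yes _ | no ne = no λ { refl → ne refl }

u1 w1 v1 u2 w2 v2 : ℕ → ℕ → DV
u1 = p zero zero
w1 = p zero (suc zero)
v1 = p zero (suc (suc zero))
u2 = p (suc zero) zero
w2 = p (suc zero) (suc zero)
v2 = p (suc zero) (suc (suc zero))

y z : ℕ → DV
y = hub zero
z = hub (suc zero)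

dfEdges : ℕ → ℕ → List (DV × DV)
dfEdges s j = concatMap (λ a →
    (u1 j a , w1 j a) ∷ (w1 j a , v1 j a) ∷
    (u2 j a , w2 j a) ∷ (w2 j a , v2 j a) ∷
    (y j , w1 j a) ∷ (y j , u2 j a) ∷ (y j , v2 j a) ∷
    (z j , u1 j a) ∷ (z j , v1 j a) ∷ (z j , w2 j a) ∷ []) (upTo s)

rDF : ℕ → ℕ → List (DV × DV)
rDF r s = concatMap (dfEdges s) (upTo r)

-- merging: a map sending each vertex to the representative of its class
mergeWith : (DV → DV) → List (DV × DV) → List (DV × DV)
mergeWith g = map (λ e → g (proj₁ e) , g (proj₂ e))

-- DF¹: merge the w^1_{j,a} over j, and the w^2_{j,a} over j
merge1 : DV → DV
merge1 (p i (suc zero) j a) = p i (suc zero) 0 a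
merge1 x = x

-- DF²: merge u^1, u^2, v^1, v^2 over j
merge2 : DV → DV
merge2 (p i zero j a) = p i zero 0 a
merge2 (p i (suc (suc zero)) j a) = p i (suc (suc zero)) 0 a
merge2 x = x

merge3 : DV → DV
merge3 (hub i j) = hub i 0
merge3 x = x

next : ℕ → ℕ → ℕ
next r j with suc j ≟ℕ r
... | yes _ = 0
... | no _ = suc j

-- DF⁴: merge y_j with z_{j+1} (indices mod r); representative z_{j+1}
merge4 : ℕ → DV → DV
merge4 r (hub zero j) = hub (suc zero) (next r j)
merge4 r x = x

DF1 DF2 DF3 DF4 : ℕ → ℕ → List (DV × DV)
DF1 r s = mergeWith merge1 (rDF r s)
DF2 r s = mergeWith merge2 (rDF r s)
DF3 r s = mergeWith merge3 (rDF r s)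
DF4 r s = mergeWith (merge4 r) (rDF r s)

χla≡ : List (DV × DV) → ℕ → Set
χla≡ E k = LocalAntimagic.ChiLa _≟DV_ E k

-- Every edge of r DF(2s) lies in one of r s copies of a ten-edge gadget on u¹, w¹, v¹, u², w², v²,
-- y, z, and in a merged graph the sum at a vertex is the total, over the gadget copies merged into
-- it, of the sums at the corresponding gadget vertex.  Labelling the q-th gadget by affine functions
-- of q and n − 1 − q (n = r s) makes these gadget sums 8n + 1 at the path ends u, v, 15n + 1 at the
-- middles w and 19n + 2 at the apexes y, z.  Hence the sums in a merged graph depend only on the
-- kind of the vertex; the divisibility hypotheses make the three values distinct, and as kinds
-- alternate along edges the labelling is local antimagic with three colours.
--
-- Conversely, a local antimagic labelling with two colours α ≠ β properly 2-colours the graph.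
-- Each gadget is bipartite with sides {y, u¹, v¹, w²} and {z, w¹, u², v²}, and the colouring
-- spreads through the merged vertices; both sides of a gadget see each of its labels exactly once.
-- Summing over all gadgets gives N α = N β, N being the common number of vertices of either colour.
-- In DF⁴ the two orientations of the gadgets alternate along the cycle of components, which needs
-- r even, and the count is done pairwise for the components 2i, 2i + 1.

{-# OPTIONS --safe #-}
module Submission where

open import Defs
open import Data.Nat
open import Data.Nat.Properties
open import Data.Nat.Tactic.RingSolver using (solve-∀)
open import Algebra.Properties.CommutativeSemigroup +-commutativeSemigroup using () renaming (interchange to +-interchange)
open import Data.Nat.Divisibility
  using (_∣_; divides; divides-refl; ∣-refl; ∣m∣n⇒∣m+n; ∣m+n∣m⇒∣n; ∣m⇒∣m*n; ∣n⇒∣m*n; *-pres-∣)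
open import Data.Nat.DivMod
open import Data.Fin as Fin using (Fin; zero; suc; toℕ; fromℕ<; punchOut; #_)
open import Data.Fin.Properties using (fromℕ<-toℕ; toℕ<n; toℕ-fromℕ<; toℕ-injective; any?; injective⇒≤; punchOut-injective)
open import Data.Fin.Permutation using (Permutation′; _⟨$⟩ʳ_; permutation)
open import Data.Bool using (Bool; true; false; if_then_else_; _∨_; _∧_; not; _xor_)
open import Data.Bool.Properties using (∧-zeroʳ; ∧-identityʳ; xor-identityʳ; not-distribˡ-xor; not-involutive)
open import Data.List using (List; []; _∷_; _++_; length; map; concat; concatMap; upTo; applyUpTo; lookup; tabulate; deduplicate)
open import Data.List.Properties using (length-++; length-map; map-upTo; map-tabulate)
open import Data.List.Relation.Unary.Any as Any using (here; there)
open import Data.List.Relation.Unary.Any.Properties using (applyUpTo⁺; applyUpTo⁻; lookup-index)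
import Data.List.Relation.Unary.All as All
open import Data.List.Relation.Unary.AllPairs using ([]; _∷_)
open import Data.List.Relation.Unary.Unique.Propositional using (Unique)
open import Data.List.Relation.Unary.Unique.DecPropositional.Properties _≟_ using (deduplicate-!)
open import Data.List.Relation.Binary.Subset.Propositional using (_⊆_)
open import Data.List.Membership.Propositional using (_∈_; find)
open import Data.List.Membership.Propositional.Properties
  using ( ∈-map⁺; ∈-map⁻; ∈-concatMap⁺; ∈-concatMap⁻; ∈-∃++; ∈-++⁻; ∈-++⁺ˡ; ∈-++⁺ʳ
        ; ∈-deduplicate⁺; ∈-deduplicate⁻; ∈-lookup)
open import Data.Nat.ListAction using (sum)
open import Data.Product using (Σ; ∃; ∃₂; _×_; _,_; proj₁; proj₂)
open import Data.Sum using (_⊎_; inj₁; inj₂)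
open import Function using (_∘_; id)
open import Relation.Nullary using (¬_; Dec; yes; no; ⌊_⌋; contradiction)
open import Relation.Nullary.Decidable using (isYes≗does; does-⇔)
open import Function.Bundles using (mk⇔)
open import Relation.Binary.PropositionalEquality
open import Data.Empty using (⊥)

module LA = LocalAntimagic _≟DV_

-- Finite sums

∑ : ℕ → (ℕ → ℕ) → ℕ
∑ zero    f = 0
∑ (suc n) f = f 0 + ∑ n (f ∘ suc)

syntax ∑ n (λ i → e) = ∑[ i < n ] e

∑-cong : ∀ n {f g : ℕ → ℕ} → (∀ i → i < n → f i ≡ g i) → ∑ n f ≡ ∑ n g
∑-cong zero    eq = refl
∑-cong (suc n) eq = cong₂ _+_ (eq 0 z<s) (∑-cong n (λ i i<n → eq (suc i) (s<s i<n)))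

∑-const : ∀ n {f : ℕ → ℕ} c → (∀ i → i < n → f i ≡ c) → ∑ n f ≡ n * c
∑-const zero    c eq = refl
∑-const (suc n) c eq = cong₂ _+_ (eq 0 z<s) (∑-const n c (λ i i<n → eq (suc i) (s<s i<n)))

∑-zero : ∀ n → ∑[ i < n ] 0 ≡ 0
∑-zero n = trans (∑-const n 0 (λ _ _ → refl)) (*-zeroʳ n)

∑-distrib-+ : ∀ n (f g : ℕ → ℕ) → ∑[ i < n ] (f i + g i) ≡ ∑ n f + ∑ n g
∑-distrib-+ zero    f g = refl
∑-distrib-+ (suc n) f g =
  trans (cong (f 0 + g 0 +_) (∑-distrib-+ n (f ∘ suc) (g ∘ suc))) (+-interchange (f 0) (g 0) _ _)

∑-comm : ∀ m n (f : ℕ → ℕ → ℕ) → ∑[ i < m ] ∑[ j < n ] f i j ≡ ∑[ j < n ] ∑[ i < m ] f i j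
∑-comm zero    n f = sym (∑-zero n)
∑-comm (suc m) n f = trans (cong (∑ n (f 0) +_) (∑-comm m n (f ∘ suc)))
                           (sym (∑-distrib-+ n (f 0) (λ j → ∑[ i < m ] f (suc i) j)))

∑-init-last : ∀ n (f : ℕ → ℕ) → ∑ (suc n) f ≡ ∑ n f + f n
∑-init-last zero    f = +-comm (f 0) 0
∑-init-last (suc n) f = trans (cong (f 0 +_) (∑-init-last n (f ∘ suc))) (sym (+-assoc (f 0) _ _))

∑-if : ∀ n b (f : ℕ → ℕ) → ∑[ i < n ] (if b then f i else 0) ≡ (if b then ∑ n f else 0)
∑-if n true  f = refl
∑-if n false f = ∑-zero n

⌊⌋-⇔ : ∀ {A B : Set} (a? : Dec A) (b? : Dec B) → (A → B) → (B → A) → ⌊ a? ⌋ ≡ ⌊ b? ⌋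
⌊⌋-⇔ a? b? f g = trans (isYes≗does a?) (trans (does-⇔ (mk⇔ f g) a? b?) (sym (isYes≗does b?)))

⌊suc≟suc⌋ : ∀ a b → ⌊ suc a ≟ suc b ⌋ ≡ ⌊ a ≟ b ⌋
⌊suc≟suc⌋ a b = ⌊⌋-⇔ (suc a ≟ suc b) (a ≟ b) suc-injective (cong suc)

∑-δ : ∀ {i₀ n} (f : ℕ → ℕ) → i₀ < n → ∑[ i < n ] (if ⌊ i₀ ≟ i ⌋ then f i else 0) ≡ f i₀
∑-δ {zero}   {suc n} f _           = trans (cong (f 0 +_) (∑-zero n)) (+-identityʳ (f 0))
∑-δ {suc i₀} {suc n} f (s<s i₀<n) =
  trans (∑-cong n (λ i _ → cong (λ b → if b then f (suc i) else 0) (⌊suc≟suc⌋ i₀ i))) (∑-δ (f ∘ suc) i₀<n)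

∑∑-δ : ∀ {r j₀} s (f : ℕ → ℕ → ℕ) → j₀ < r →
  ∑[ j < r ] ∑[ a < s ] (if ⌊ j₀ ≟ j ⌋ then f j a else 0) ≡ ∑[ a < s ] f j₀ a
∑∑-δ {r} s f j₀<r = trans (∑-cong r (λ j _ → ∑-if s _ (f j))) (∑-δ (λ j → ∑ s (f j)) j₀<r)

∑∑-distrib-+ : ∀ r s (f g : ℕ → ℕ → ℕ) →
  ∑[ j < r ] ∑[ a < s ] (f j a + g j a) ≡ ∑[ j < r ] ∑[ a < s ] f j a + ∑[ j < r ] ∑[ a < s ] g j a
∑∑-distrib-+ r s f g = trans (∑-cong r (λ j _ → ∑-distrib-+ s (f j) (g j))) (∑-distrib-+ r _ _)

classSum : ℕ → Bool → (ℕ → ℕ) → ℕ → ℕ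
classSum n true  f i₀ = ∑ n f
classSum n false f i₀ = f i₀

∑-classSum : ∀ n c f {i₀} → i₀ < n → ∑[ i < n ] (if c ∨ ⌊ i₀ ≟ i ⌋ then f i else 0) ≡ classSum n c f i₀
∑-classSum n true  f _    = refl
∑-classSum n false f i₀<n = ∑-δ f i₀<n

sameClass : Bool → Bool → ℕ → ℕ → ℕ → ℕ → Bool
sameClass c d j₀ a₀ j a = (c ∨ ⌊ j₀ ≟ j ⌋) ∧ (d ∨ ⌊ a₀ ≟ a ⌋)

∑∑-sameClass : ∀ r s c d (R : ℕ → ℕ → ℕ) {j₀ a₀} → j₀ < r → a₀ < s →
  ∑[ j < r ] ∑[ a < s ] (if sameClass c d j₀ a₀ j a then R j a else 0) ≡ classSum r c (λ j → classSum s d (R j) a₀) j₀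
∑∑-sameClass r s c d R {j₀} {a₀} j₀<r a₀<s = trans (∑-cong r λ j _ → row j) (∑-classSum r c _ j₀<r)
  where
  if-∧ : ∀ b b′ x → (if b ∧ b′ then x else 0) ≡ (if b then (if b′ then x else 0) else 0)
  if-∧ true  b′ x = refl
  if-∧ false b′ x = refl
  row : ∀ j → ∑[ a < s ] (if sameClass c d j₀ a₀ j a then R j a else 0)
            ≡ (if c ∨ ⌊ j₀ ≟ j ⌋ then classSum s d (R j) a₀ else 0)
  row j = begin
    ∑[ a < s ] (if sameClass c d j₀ a₀ j a then R j a else 0)
      ≡⟨ ∑-cong s (λ a _ → if-∧ (c ∨ ⌊ j₀ ≟ j ⌋) _ (R j a)) ⟩
    ∑[ a < s ] (if c ∨ ⌊ j₀ ≟ j ⌋ then (if d ∨ ⌊ a₀ ≟ a ⌋ then R j a else 0) else 0)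
      ≡⟨ ∑-if s (c ∨ ⌊ j₀ ≟ j ⌋) _ ⟩
    (if c ∨ ⌊ j₀ ≟ j ⌋ then ∑[ a < s ] (if d ∨ ⌊ a₀ ≟ a ⌋ then R j a else 0) else 0)
      ≡⟨ cong (λ t → if c ∨ ⌊ j₀ ≟ j ⌋ then t else 0) (∑-classSum s d (R j) a₀<s) ⟩
    (if c ∨ ⌊ j₀ ≟ j ⌋ then classSum s d (R j) a₀ else 0)
      ∎
    where open ≡-Reasoning

-- Number of gadget copies merged into one vertex, and number of merged vertices,
-- along an index with n values that is merged (c = true) or not.
copies classes : ℕ → Bool → ℕ
copies  n c = if c then n else 1
classes n c = if c then 1 else n

classSum-const : ∀ {n} c {f : ℕ → ℕ} {v i₀} → (∀ i → i < n → f i ≡ v) → i₀ < n → classSum n c f i₀ ≡ copies n c * v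
classSum-const {n} true  f≡v _    = ∑-const n _ f≡v
classSum-const     false f≡v i₀<n = trans (f≡v _ i₀<n) (sym (*-identityˡ _))

∑-classSum-const : ∀ {n} c {f : ℕ → ℕ} {v} → 0 < n → (∀ i₀ → i₀ < n → classSum n c f i₀ ≡ v) →
  ∑ n f ≡ classes n c * v
∑-classSum-const     true  0<n classSum≡v = trans (classSum≡v 0 0<n) (sym (*-identityˡ _))
∑-classSum-const {n} false _   classSum≡v = ∑-const n _ classSum≡v

∑∑-classSum-const : ∀ {r s} c d (R : ℕ → ℕ → ℕ) {v} → 0 < r → 0 < s →
  (∀ j₀ a₀ → j₀ < r → a₀ < s → classSum r c (λ j → classSum s d (R j) a₀) j₀ ≡ v) →
  ∑[ j < r ] ∑[ a < s ] R j a ≡ classes r c * (classes s d * v)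
∑∑-classSum-const {r} {s} c true R {v} 0<r 0<s classSum≡v =
  trans (∑-classSum-const c 0<r (λ j₀ j₀<r → classSum≡v j₀ 0 j₀<r 0<s)) (cong (classes r c *_) (sym (*-identityˡ v)))
∑∑-classSum-const {r} {s} c false R {v} 0<r 0<s classSum≡v = begin
  ∑[ j < r ] ∑[ a < s ] R j a      ≡⟨ ∑-comm r s R ⟩
  ∑[ a < s ] ∑[ j < r ] R j a
    ≡⟨ ∑-const s _ (λ a₀ a₀<s → ∑-classSum-const c 0<r λ j₀ j₀<r → classSum≡v j₀ a₀ j₀<r a₀<s) ⟩
  s * (classes r c * v)            ≡⟨ x*[y*z]≡y*[x*z] s (classes r c) v ⟩
  classes r c * (s * v)            ∎
  where
  open ≡-Reasoning
  x*[y*z]≡y*[x*z] : ∀ x y z → x * (y * z) ≡ y * (x * z)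
  x*[y*z]≡y*[x*z] = solve-∀

classes-pos : ∀ {n} c → 0 < n → 0 < classes n c
classes-pos true  _   = z<s
classes-pos false 0<n = 0<n

-- The diamond-fan gadget

data Role : Set where
  path : Fin 2 → Fin 3 → Role
  apex : Fin 2 → Role

pattern U₁ = path zero zero
pattern W₁ = path zero (suc zero)
pattern V₁ = path zero (suc (suc zero))
pattern U₂ = path (suc zero) zero
pattern W₂ = path (suc zero) (suc zero)
pattern V₂ = path (suc zero) (suc (suc zero))
pattern Y  = apex zero
pattern Z  = apex (suc zero)

_≟ᴿ_ : (ρ σ : Role) → Dec (ρ ≡ σ)
path i k ≟ᴿ path i′ k′ with i Fin.≟ i′ | k Fin.≟ k′
... | yes refl | yes refl = yes refl
... | no i≢i′  | _        = no λ { refl → i≢i′ refl }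
... | yes _    | no k≢k′  = no λ { refl → k≢k′ refl }
path _ _ ≟ᴿ apex _ = no λ ()
apex _ ≟ᴿ path _ _ = no λ ()
apex i ≟ᴿ apex i′ with i Fin.≟ i′
... | yes refl = yes refl
... | no i≢i′  = no λ { refl → i≢i′ refl }

isApex : Role → Bool
isApex (path _ _) = false
isApex (apex _)   = true

vertex : Role → ℕ → ℕ → DV
vertex (path i k) j a = p i k j a
vertex (apex i)   j a = hub i j

vertex-≟ : ∀ ρ σ j a j′ a′ →
  ⌊ vertex ρ j a ≟DV vertex σ j′ a′ ⌋ ≡ ⌊ ρ ≟ᴿ σ ⌋ ∧ (⌊ j ≟ j′ ⌋ ∧ (isApex σ ∨ ⌊ a ≟ a′ ⌋))
vertex-≟ (path i k) (path i′ k′) j a j′ a′ with i Fin.≟ i′ | k Fin.≟ k′ | j ≟ j′ | a ≟ a′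
... | yes refl | yes refl | yes refl | yes refl = refl
... | yes refl | yes refl | yes refl | no _     = refl
... | yes refl | yes refl | no _     | _        = refl
... | yes refl | no _     | _        | _        = refl
... | no _     | _        | _        | _        = refl
vertex-≟ (path _ _) (apex _) j a j′ a′ = refl
vertex-≟ (apex _) (path _ _) j a j′ a′ = refl
vertex-≟ (apex i) (apex i′) j a j′ a′ with i Fin.≟ i′ | j ≟ j′
... | yes refl | yes refl = refl
... | yes refl | no _     = refl
... | no _     | _        = refl

gadgetEdges : List (Role × Role)
gadgetEdges = (U₁ , W₁) ∷ (W₁ , V₁) ∷ (U₂ , W₂) ∷ (W₂ , V₂) ∷
              (Y , W₁) ∷ (Y , U₂) ∷ (Y , V₂) ∷ (Z , U₁) ∷ (Z , V₁) ∷ (Z , W₂) ∷ []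

U₁W₁ : (U₁ , W₁) ∈ gadgetEdges
U₁W₁ = here refl
W₁V₁ : (W₁ , V₁) ∈ gadgetEdges
W₁V₁ = there (here refl)
YW₁ : (Y , W₁) ∈ gadgetEdges
YW₁ = there (there (there (there (here refl))))
YU₂ : (Y , U₂) ∈ gadgetEdges
YU₂ = there (there (there (there (there (here refl)))))
YV₂ : (Y , V₂) ∈ gadgetEdges
YV₂ = there (there (there (there (there (there (here refl))))))
ZU₁ : (Z , U₁) ∈ gadgetEdges
ZU₁ = there (there (there (there (there (there (there (here refl)))))))
ZW₂ : (Z , W₂) ∈ gadgetEdges
ZW₂ = there (there (there (there (there (there (there (there (there (here refl)))))))))

gadget : ℕ → ℕ → List (DV × DV)
gadget j a = map (λ e → vertex (proj₁ e) j a , vertex (proj₂ e) j a) gadgetEdges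

data Kind : Set where
  end middle apical : Kind

kind : Role → Kind
kind (path _ zero)             = end
kind (path _ (suc zero))       = middle
kind (path _ (suc (suc zero))) = end
kind (apex _)                  = apical

_==ᴷ_ : Kind → Kind → Bool
end    ==ᴷ end    = true
middle ==ᴷ middle = true
apical ==ᴷ apical = true
_      ==ᴷ _      = false

isApex≡ : ∀ ρ → isApex ρ ≡ kind ρ ==ᴷ apical
isApex≡ (path _ zero)             = refl
isApex≡ (path _ (suc zero))       = refl
isApex≡ (path _ (suc (suc zero))) = refl
isApex≡ (apex _)                  = refl

gadgetEdge-kinds : ∀ {ρ σ} → (ρ , σ) ∈ gadgetEdges → kind ρ ≢ kind σ
gadgetEdge-kinds = All.lookup {P = λ e → kind (proj₁ e) ≢ kind (proj₂ e)}
  ((λ ()) All.∷ (λ ()) All.∷ (λ ()) All.∷ (λ ()) All.∷ (λ ()) All.∷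
   (λ ()) All.∷ (λ ()) All.∷ (λ ()) All.∷ (λ ()) All.∷ (λ ()) All.∷ All.[])

onA : Role → Bool
onA U₁ = true
onA W₁ = false
onA V₁ = true
onA U₂ = false
onA W₂ = true
onA V₂ = false
onA Y  = true
onA Z  = false

onA-edge : ∀ {ρ σ} → (ρ , σ) ∈ gadgetEdges → onA σ ≡ not (onA ρ)
onA-edge = All.lookup {P = λ e → onA (proj₂ e) ≡ not (onA (proj₁ e))}
  (refl All.∷ refl All.∷ refl All.∷ refl All.∷ refl All.∷ refl All.∷ refl All.∷ refl All.∷ refl All.∷ refl All.∷ All.[])

incidenceSum : (Role → Bool) → List (Role × Role) → (ℕ → ℕ) → ℕ
incidenceSum χ []             G = 0
incidenceSum χ ((ρ , σ) ∷ es) G = (if χ ρ ∨ χ σ then G 0 else 0) + incidenceSum χ es (G ∘ suc)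

gadgetSum : (Role → Bool) → (ℕ → ℕ) → ℕ
gadgetSum χ = incidenceSum χ gadgetEdges

gadgetSum-cong : ∀ {χ ψ} → (∀ σ → χ σ ≡ ψ σ) → ∀ G → gadgetSum χ G ≡ gadgetSum ψ G
gadgetSum-cong {χ} {ψ} χ≗ψ = go gadgetEdges
  where
  go : ∀ es G → incidenceSum χ es G ≡ incidenceSum ψ es G
  go []             G = refl
  go ((ρ , σ) ∷ es) G = cong₂ (λ b t → (if b then G 0 else 0) + t) (cong₂ _∨_ (χ≗ψ ρ) (χ≗ψ σ)) (go es (G ∘ suc))

roleSum : Role → (ℕ → ℕ) → ℕ
roleSum U₁ G = G 0 + G 7
roleSum W₁ G = G 0 + G 1 + G 4
roleSum V₁ G = G 1 + G 8
roleSum U₂ G = G 2 + G 5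
roleSum W₂ G = G 2 + G 3 + G 9
roleSum V₂ G = G 3 + G 6
roleSum Y  G = G 4 + G 5 + G 6
roleSum Z  G = G 7 + G 8 + G 9

roleSum-cong : ∀ ρ {G G′ : ℕ → ℕ} → (∀ (k : Fin 10) → G (toℕ k) ≡ G′ (toℕ k)) → roleSum ρ G ≡ roleSum ρ G′
roleSum-cong U₁ eq = cong₂ _+_ (eq (# 0)) (eq (# 7))
roleSum-cong W₁ eq = cong₂ _+_ (cong₂ _+_ (eq (# 0)) (eq (# 1))) (eq (# 4))
roleSum-cong V₁ eq = cong₂ _+_ (eq (# 1)) (eq (# 8))
roleSum-cong U₂ eq = cong₂ _+_ (eq (# 2)) (eq (# 5))
roleSum-cong W₂ eq = cong₂ _+_ (cong₂ _+_ (eq (# 2)) (eq (# 3))) (eq (# 9))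
roleSum-cong V₂ eq = cong₂ _+_ (eq (# 3)) (eq (# 6))
roleSum-cong Y  eq = cong₂ _+_ (cong₂ _+_ (eq (# 4)) (eq (# 5))) (eq (# 6))
roleSum-cong Z  eq = cong₂ _+_ (cong₂ _+_ (eq (# 7)) (eq (# 8))) (eq (# 9))

gadgetSum-role : ∀ ρ G → gadgetSum (λ σ → ⌊ ρ ≟ᴿ σ ⌋) G ≡ roleSum ρ G
gadgetSum-role U₁ G = cong (G 0 +_) (+-identityʳ (G 7))
gadgetSum-role W₁ G = trans (sym (+-assoc (G 0) (G 1) _)) (cong (G 0 + G 1 +_) (+-identityʳ (G 4)))
gadgetSum-role V₁ G = cong (G 1 +_) (+-identityʳ (G 8))
gadgetSum-role U₂ G = cong (G 2 +_) (+-identityʳ (G 5))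
gadgetSum-role W₂ G = trans (sym (+-assoc (G 2) (G 3) _)) (cong (G 2 + G 3 +_) (+-identityʳ (G 9)))
gadgetSum-role V₂ G = cong (G 3 +_) (+-identityʳ (G 6))
gadgetSum-role Y  G = trans (sym (+-assoc (G 4) (G 5) _)) (cong (G 4 + G 5 +_) (+-identityʳ (G 6)))
gadgetSum-role Z  G = trans (sym (+-assoc (G 7) (G 8) _)) (cong (G 7 + G 8 +_) (+-identityʳ (G 9)))

gadgetSum-single : ∀ ρ b G → gadgetSum (λ σ → ⌊ ρ ≟ᴿ σ ⌋ ∧ b) G ≡ (if b then roleSum ρ G else 0)
gadgetSum-single ρ false G = gadgetSum-cong {ψ = λ _ → false} (λ σ → ∧-zeroʳ ⌊ ρ ≟ᴿ σ ⌋) G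
gadgetSum-single ρ true  G =
  trans (gadgetSum-cong {ψ = λ σ → ⌊ ρ ≟ᴿ σ ⌋} (λ σ → ∧-identityʳ ⌊ ρ ≟ᴿ σ ⌋) G) (gadgetSum-role ρ G)

gadgetSum-apexes : ∀ b b′ G → gadgetSum (λ σ → (⌊ Y ≟ᴿ σ ⌋ ∧ b) ∨ (⌊ Z ≟ᴿ σ ⌋ ∧ b′)) G
                              ≡ (if b then roleSum Y G else 0) + (if b′ then roleSum Z G else 0)
gadgetSum-apexes true  true  G = both (G 4) (G 5) (G 6) (G 7) (G 8) (G 9)
  where
  both : ∀ g₄ g₅ g₆ g₇ g₈ g₉ → g₄ + (g₅ + (g₆ + (g₇ + (g₈ + (g₉ + 0))))) ≡ g₄ + g₅ + g₆ + (g₇ + g₈ + g₉)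
  both = solve-∀
gadgetSum-apexes true  false G = trans (gadgetSum-role Y G) (sym (+-identityʳ _))
gadgetSum-apexes false true  G = gadgetSum-role Z G
gadgetSum-apexes false false G = refl

-- Both sides of the bipartite gadget see every edge label exactly once.
gadget-balance : ∀ G → roleSum Y G + (roleSum U₁ G + roleSum V₁ G + roleSum W₂ G)
                     ≡ roleSum Z G + (roleSum W₁ G + roleSum U₂ G + roleSum V₂ G)
gadget-balance G = balance (G 0) (G 1) (G 2) (G 3) (G 4) (G 5) (G 6) (G 7) (G 8) (G 9)
  where
  balance : ∀ g₀ g₁ g₂ g₃ g₄ g₅ g₆ g₇ g₈ g₉ →
    g₄ + g₅ + g₆ + (g₀ + g₇ + (g₁ + g₈) + (g₂ + g₃ + g₉))
      ≡ g₇ + g₈ + g₉ + (g₀ + g₁ + g₄ + (g₂ + g₅) + (g₃ + g₆))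
  balance = solve-∀

-- Vertex sums of merged copies of r DF(2s)

incident : DV → DV × DV → Bool
incident x (u , v) = ⌊ x ≟DV u ⌋ ∨ ⌊ x ≟DV v ⌋

-- f⁺(x) in the graph mergeWith h E, when the i-th edge of E carries the label F i.
inducedSum : (DV → DV) → List (DV × DV) → (ℕ → ℕ) → DV → ℕ
inducedSum h []            F x = 0
inducedSum h ((u , v) ∷ E) F x = (if incident x (h u , h v) then F 0 else 0) + inducedSum h E (F ∘ suc) x

inducedSum-cong : ∀ h E x {F G : ℕ → ℕ} → (∀ i → F i ≡ G i) → inducedSum h E F x ≡ inducedSum h E G x
inducedSum-cong h []            x F≗G = refl
inducedSum-cong h ((u , v) ∷ E) x F≗G =
  cong₂ (λ l t → (if incident x (h u , h v) then l else 0) + t) (F≗G 0) (inducedSum-cong h E x (F≗G ∘ suc))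

inducedSum-++ : ∀ h A B F x →
  inducedSum h (A ++ B) F x ≡ inducedSum h A F x + inducedSum h B (λ i → F (length A + i)) x
inducedSum-++ h []            B F x = refl
inducedSum-++ h ((u , v) ∷ A) B F x =
  trans (cong (t +_) (inducedSum-++ h A B (F ∘ suc) x)) (sym (+-assoc t (inducedSum h A (F ∘ suc) x) _))
  where t = if incident x (h u , h v) then F 0 else 0

length-concat-applyUpTo : ∀ {A : Set} (f : ℕ → List A) L → (∀ i → length (f i) ≡ L) →
  ∀ n → length (concat (applyUpTo f n)) ≡ n * L
length-concat-applyUpTo f L length-f zero    = refl
length-concat-applyUpTo f L length-f (suc n) = trans (length-++ (f 0))
  (cong₂ _+_ (length-f 0) (length-concat-applyUpTo (f ∘ suc) L (length-f ∘ suc) n))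

inducedSum-concat : ∀ h (f : ℕ → List (DV × DV)) L → (∀ i → length (f i) ≡ L) → ∀ n F x →
  inducedSum h (concat (applyUpTo f n)) F x ≡ ∑[ i < n ] inducedSum h (f i) (λ k → F (i * L + k)) x
inducedSum-concat h f L length-f zero    F x = refl
inducedSum-concat h f L length-f (suc n) F x = begin
  inducedSum h (f 0 ++ concat (applyUpTo (f ∘ suc) n)) F x
    ≡⟨ inducedSum-++ h (f 0) _ F x ⟩
  inducedSum h (f 0) F x + inducedSum h (concat (applyUpTo (f ∘ suc) n)) (λ i → F (length (f 0) + i)) x
    ≡⟨ cong (inducedSum h (f 0) F x +_) (inducedSum-concat h (f ∘ suc) L (length-f ∘ suc) n _ x) ⟩
  inducedSum h (f 0) F x + ∑[ i < n ] inducedSum h (f (suc i)) (λ k → F (length (f 0) + (i * L + k))) x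
    ≡⟨ cong (inducedSum h (f 0) F x +_) (∑-cong n λ i _ → inducedSum-cong h (f (suc i)) x λ k →
         cong F (trans (cong (_+ (i * L + k)) (length-f 0)) (sym (+-assoc L (i * L) k)))) ⟩
  inducedSum h (f 0) F x + ∑[ i < n ] inducedSum h (f (suc i)) (λ k → F (suc i * L + k)) x
    ∎
  where open ≡-Reasoning

-- The label of edge k of the gadget (j , a), edges of rDF r s being numbered in order.
gadgetLabels : (ℕ → ℕ) → ℕ → ℕ → ℕ → ℕ → ℕ
gadgetLabels F s j a k = F (j * (s * 10) + (a * 10 + k))

length-dfEdges : ∀ s j → length (dfEdges s j) ≡ s * 10
length-dfEdges s j = trans (cong (length ∘ concat) (map-upTo (gadget j) s))
                           (length-concat-applyUpTo (gadget j) 10 (λ _ → refl) s)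

length-rDF : ∀ r s → length (rDF r s) ≡ r * (s * 10)
length-rDF r s = trans (cong (length ∘ concat) (map-upTo (dfEdges s) r))
                       (length-concat-applyUpTo (dfEdges s) (s * 10) (length-dfEdges s) r)

inducedSum-rDF : ∀ h r s F x →
  inducedSum h (rDF r s) F x ≡ ∑[ j < r ] ∑[ a < s ] inducedSum h (gadget j a) (gadgetLabels F s j a) x
inducedSum-rDF h r s F x = begin
  inducedSum h (concat (map (dfEdges s) (upTo r))) F x
    ≡⟨ cong (λ E → inducedSum h (concat E) F x) (map-upTo (dfEdges s) r) ⟩
  inducedSum h (concat (applyUpTo (dfEdges s) r)) F x
    ≡⟨ inducedSum-concat h (dfEdges s) (s * 10) (length-dfEdges s) r F x ⟩
  ∑[ j < r ] inducedSum h (concat (map (gadget j) (upTo s))) (λ i → F (j * (s * 10) + i)) x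
    ≡⟨ ∑-cong r (λ j _ → cong (λ E → inducedSum h (concat E) (λ i → F (j * (s * 10) + i)) x) (map-upTo (gadget j) s)) ⟩
  ∑[ j < r ] inducedSum h (concat (applyUpTo (gadget j) s)) (λ i → F (j * (s * 10) + i)) x
    ≡⟨ ∑-cong r (λ j _ → inducedSum-concat h (gadget j) 10 (λ _ → refl) s _ x) ⟩
  ∑[ j < r ] ∑[ a < s ] inducedSum h (gadget j a) (gadgetLabels F s j a) x
    ∎
  where open ≡-Reasoning

totals-balance : ∀ r s (G : ℕ → ℕ → ℕ → ℕ) →
  let T = λ ρ → ∑[ j < r ] ∑[ a < s ] roleSum ρ (G j a) in
  T Y + (T U₁ + T V₁ + T W₂) ≡ T Z + (T W₁ + T U₂ + T V₂)
totals-balance r s G = begin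
  T Y + (T U₁ + T V₁ + T W₂)
    ≡⟨ ∑∑-+₄ (R Y) (R U₁) (R V₁) (R W₂) ⟨
  ∑[ j < r ] ∑[ a < s ] (R Y j a + (R U₁ j a + R V₁ j a + R W₂ j a))
    ≡⟨ ∑-cong r (λ j _ → ∑-cong s λ a _ → gadget-balance (G j a)) ⟩
  ∑[ j < r ] ∑[ a < s ] (R Z j a + (R W₁ j a + R U₂ j a + R V₂ j a))
    ≡⟨ ∑∑-+₄ (R Z) (R W₁) (R U₂) (R V₂) ⟩
  T Z + (T W₁ + T U₂ + T V₂)
    ∎
  where
  open ≡-Reasoning
  R : Role → ℕ → ℕ → ℕ
  R ρ j a = roleSum ρ (G j a)
  T : Role → ℕ
  T ρ = ∑[ j < r ] ∑[ a < s ] R ρ j a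
  ∑∑ : (ℕ → ℕ → ℕ) → ℕ
  ∑∑ f = ∑[ j < r ] ∑[ a < s ] f j a
  ∑∑-+₄ : ∀ f₁ f₂ f₃ f₄ →
    ∑∑ (λ j a → f₁ j a + (f₂ j a + f₃ j a + f₄ j a)) ≡ ∑∑ f₁ + (∑∑ f₂ + ∑∑ f₃ + ∑∑ f₄)
  ∑∑-+₄ f₁ f₂ f₃ f₄ = trans (∑∑-distrib-+ r s f₁ _) (cong (∑∑ f₁ +_)
    (trans (∑∑-distrib-+ r s _ f₄) (cong (_+ ∑∑ f₄) (∑∑-distrib-+ r s f₂ f₃))))

inducedSum-role : ∀ h {x} ρ (b : ℕ → ℕ → Bool) →
  (∀ σ j a → ⌊ x ≟DV h (vertex σ j a) ⌋ ≡ ⌊ ρ ≟ᴿ σ ⌋ ∧ b j a) → ∀ r s F →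
  inducedSum h (rDF r s) F x ≡ ∑[ j < r ] ∑[ a < s ] (if b j a then roleSum ρ (gadgetLabels F s j a) else 0)
inducedSum-role h {x} ρ b x≟ r s F = trans (inducedSum-rDF h r s F x) (∑-cong r λ j _ → ∑-cong s λ a _ →
  trans (gadgetSum-cong (λ σ → x≟ σ j a) (gadgetLabels F s j a)) (gadgetSum-single ρ (b j a) (gadgetLabels F s j a)))

-- h identifies the copy of ρ in gadget (j₀, a₀) with exactly the copies of ρ in the gadgets (j, a)
-- of the same class: those of all components if c, of all gadgets of the component if ρ is an apex.
Identifies : (DV → DV) → Bool → Role → Set
Identifies h c ρ = ∀ j₀ a₀ σ j a →
  ⌊ h (vertex ρ j₀ a₀) ≟DV h (vertex σ j a) ⌋ ≡ ⌊ ρ ≟ᴿ σ ⌋ ∧ sameClass c (isApex ρ) j₀ a₀ j a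

inducedSum-vertex : ∀ {h c ρ} → Identifies h c ρ → ∀ r s F {j₀ a₀} → j₀ < r → a₀ < s →
  inducedSum h (rDF r s) F (h (vertex ρ j₀ a₀))
    ≡ classSum r c (λ j → classSum s (isApex ρ) (λ a → roleSum ρ (gadgetLabels F s j a)) a₀) j₀
inducedSum-vertex {h} {c} {ρ} ident r s F {j₀} {a₀} j₀<r a₀<s =
  trans (inducedSum-role h ρ (sameClass c (isApex ρ) j₀ a₀) (ident j₀ a₀) r s F)
        (∑∑-sameClass r s c (isApex ρ) (λ j a → roleSum ρ (gadgetLabels F s j a)) j₀<r a₀<s)

-- DF¹, DF² and DF³ merge the r copies of every vertex of kind middle, end and apical respectively.
Merges : Kind → (DV → DV) → Set
Merges κ h = ∀ ρ j a → h (vertex ρ j a) ≡ vertex ρ (if kind ρ ==ᴷ κ then 0 else j) a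

merge1-merges : Merges middle merge1
merge1-merges (path _ zero)             j a = refl
merge1-merges (path _ (suc zero))       j a = refl
merge1-merges (path _ (suc (suc zero))) j a = refl
merge1-merges (apex _)                  j a = refl

merge2-merges : Merges end merge2
merge2-merges (path _ zero)             j a = refl
merge2-merges (path _ (suc zero))       j a = refl
merge2-merges (path _ (suc (suc zero))) j a = refl
merge2-merges (apex _)                  j a = refl

merge3-merges : Merges apical merge3
merge3-merges (path _ zero)             j a = refl
merge3-merges (path _ (suc zero))       j a = refl
merge3-merges (path _ (suc (suc zero))) j a = refl
merge3-merges (apex _)                  j a = refl

Merges⇒Identifies : ∀ {κ h} → Merges κ h → ∀ ρ → Identifies h (kind ρ ==ᴷ κ) ρ
Merges⇒Identifies {κ} {h} merges ρ j₀ a₀ σ j a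
  rewrite merges ρ j₀ a₀ | merges σ j a
        | vertex-≟ ρ σ (if kind ρ ==ᴷ κ then 0 else j₀) a₀ (if kind σ ==ᴷ κ then 0 else j) a
  with ρ ≟ᴿ σ
... | no _     = refl
... | yes refl with kind ρ ==ᴷ κ
...   | true  = refl
...   | false = refl

next-suc : ∀ {r j} → suc j < r → next r j ≡ suc j
next-suc {r} {j} 1+j<r with suc j ≟ r
... | yes 1+j≡r = contradiction 1+j≡r (<⇒≢ 1+j<r)
... | no _      = refl

next-last : ∀ {r j} → suc j ≡ r → next r j ≡ 0
next-last {r} {j} 1+j≡r with suc j ≟ r
... | yes _      = refl
... | no 1+j≢r   = contradiction 1+j≡r 1+j≢r

next<r : ∀ {r j} → j < r → next r j < r
next<r {r} {j} j<r with suc j ≟ r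
... | yes _      = ≤-<-trans z≤n j<r
... | no 1+j≢r   = ≤∧≢⇒< j<r 1+j≢r

prev : ℕ → ℕ → ℕ
prev r zero    = pred r
prev r (suc j) = j

prev<r : ∀ {r j} → j < r → prev r j < r
prev<r {suc r} {zero}  _   = n<1+n r
prev<r {r}     {suc j} j<r = <-trans (n<1+n j) j<r

⌊≟next⌋ : ∀ {r j₀ j} → j₀ < r → j < r → ⌊ j₀ ≟ next r j ⌋ ≡ ⌊ prev r j₀ ≟ j ⌋
⌊≟next⌋ {r} {j₀} {j} j₀<r j<r with suc j ≟ r
... | yes 1+j≡r = ⌊⌋-⇔ (j₀ ≟ 0) (prev r j₀ ≟ j) (λ { refl → cong pred (sym 1+j≡r) }) (to0 j₀ j₀<r)
  where
  to0 : ∀ j₀ → j₀ < r → prev r j₀ ≡ j → j₀ ≡ 0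
  to0 zero     _      _    = refl
  to0 (suc j₀) 1+j₀<r refl = contradiction (subst (suc j <_) (sym 1+j≡r) 1+j₀<r) (<-irrefl refl)
... | no 1+j≢r  = ⌊⌋-⇔ (j₀ ≟ suc j) (prev r j₀ ≟ j) (λ { refl → refl }) (from j₀ j₀<r)
  where
  from : ∀ j₀ → j₀ < r → prev r j₀ ≡ j → j₀ ≡ suc j
  from zero     0<r  refl = contradiction (suc-pred r ⦃ >-nonZero 0<r ⦄) 1+j≢r
  from (suc j₀) _    refl = refl

prev-next : ∀ {r j} → j < r → prev r (next r j) ≡ j
prev-next {r} {j} j<r with suc j ≟ r
... | yes 1+j≡r = cong pred (sym 1+j≡r)
... | no _      = refl

merge4-identifies-path : ∀ r i k → Identifies (merge4 r) false (path i k)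
merge4-identifies-path r i k j₀ a₀ (path i′ k′)     j a = vertex-≟ (path i k) (path i′ k′) j₀ a₀ j a
merge4-identifies-path r i k j₀ a₀ (apex zero)       j a = refl
merge4-identifies-path r i k j₀ a₀ (apex (suc zero)) j a = refl

inducedSum-merge4-path : ∀ r s F i k {j a} → j < r → a < s →
  inducedSum (merge4 r) (rDF r s) F (vertex (path i k) j a) ≡ roleSum (path i k) (gadgetLabels F s j a)
inducedSum-merge4-path r s F i k = inducedSum-vertex {merge4 r} {false} {path i k} (merge4-identifies-path r i k) r s F

merge4-hub-≟ : ∀ r j₀ σ j a →
  ⌊ z j₀ ≟DV merge4 r (vertex σ j a) ⌋ ≡ (⌊ Y ≟ᴿ σ ⌋ ∧ ⌊ j₀ ≟ next r j ⌋) ∨ (⌊ Z ≟ᴿ σ ⌋ ∧ ⌊ j₀ ≟ j ⌋)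
merge4-hub-≟ r j₀ (path _ _) j a = refl
merge4-hub-≟ r j₀ Y j a with j₀ ≟ next r j
... | yes refl = refl
... | no _     = refl
merge4-hub-≟ r j₀ Z j a with j₀ ≟ j
... | yes refl = refl
... | no _     = refl

inducedSum-hub : ∀ r s F {j₀} → j₀ < r →
  inducedSum (merge4 r) (rDF r s) F (z j₀)
    ≡ ∑[ a < s ] roleSum Y (gadgetLabels F s (prev r j₀) a) + ∑[ a < s ] roleSum Z (gadgetLabels F s j₀ a)
inducedSum-hub r s F {j₀} j₀<r = begin
  inducedSum (merge4 r) (rDF r s) F (z j₀)
    ≡⟨ inducedSum-rDF (merge4 r) r s F (z j₀) ⟩
  ∑[ j < r ] ∑[ a < s ] gadgetSum (λ σ → ⌊ z j₀ ≟DV merge4 r (vertex σ j a) ⌋) (G j a)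
    ≡⟨ ∑-cong r (λ j j<r → ∑-cong s λ a _ → gadget-hub j j<r a) ⟩
  ∑[ j < r ] ∑[ a < s ] ((if ⌊ prev r j₀ ≟ j ⌋ then RY j a else 0) + (if ⌊ j₀ ≟ j ⌋ then RZ j a else 0))
    ≡⟨ ∑∑-distrib-+ r s _ _ ⟩
  ∑[ j < r ] ∑[ a < s ] (if ⌊ prev r j₀ ≟ j ⌋ then RY j a else 0)
    + ∑[ j < r ] ∑[ a < s ] (if ⌊ j₀ ≟ j ⌋ then RZ j a else 0)
    ≡⟨ cong₂ _+_ (∑∑-δ s RY (prev<r j₀<r)) (∑∑-δ s RZ j₀<r) ⟩
  ∑[ a < s ] RY (prev r j₀) a + ∑[ a < s ] RZ j₀ a
    ∎
  where
  open ≡-Reasoning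
  G = gadgetLabels F s
  RY RZ : ℕ → ℕ → ℕ
  RY j a = roleSum Y (G j a)
  RZ j a = roleSum Z (G j a)
  gadget-hub : ∀ j → j < r → ∀ a → gadgetSum (λ σ → ⌊ z j₀ ≟DV merge4 r (vertex σ j a) ⌋) (G j a)
                                 ≡ (if ⌊ prev r j₀ ≟ j ⌋ then RY j a else 0) + (if ⌊ j₀ ≟ j ⌋ then RZ j a else 0)
  gadget-hub j j<r a = begin
    gadgetSum (λ σ → ⌊ z j₀ ≟DV merge4 r (vertex σ j a) ⌋) (G j a)
      ≡⟨ gadgetSum-cong (λ σ → merge4-hub-≟ r j₀ σ j a) (G j a) ⟩
    gadgetSum (λ σ → (⌊ Y ≟ᴿ σ ⌋ ∧ ⌊ j₀ ≟ next r j ⌋) ∨ (⌊ Z ≟ᴿ σ ⌋ ∧ ⌊ j₀ ≟ j ⌋)) (G j a)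
      ≡⟨ gadgetSum-apexes ⌊ j₀ ≟ next r j ⌋ ⌊ j₀ ≟ j ⌋ (G j a) ⟩
    (if ⌊ j₀ ≟ next r j ⌋ then RY j a else 0) + (if ⌊ j₀ ≟ j ⌋ then RZ j a else 0)
      ≡⟨ cong (λ b → (if b then RY j a else 0) + (if ⌊ j₀ ≟ j ⌋ then RZ j a else 0)) (⌊≟next⌋ j₀<r j<r) ⟩
    (if ⌊ prev r j₀ ≟ j ⌋ then RY j a else 0) + (if ⌊ j₀ ≟ j ⌋ then RZ j a else 0)
      ∎

-- Labellings, vertex sums and colours

-- The label of the i-th edge, extended by 0 past the last edge.
labelAt : ∀ E → LA.Labeling E → ℕ → ℕ
labelAt E π i with i <? length E
... | yes i<m = LA.label E π (fromℕ< i<m)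
... | no _    = 0

labelAt-toℕ : ∀ E (π : LA.Labeling E) i → labelAt E π (toℕ i) ≡ LA.label E π i
labelAt-toℕ E π i with toℕ i <? length E
... | yes i<m = cong (LA.label E π) (fromℕ<-toℕ i i<m)
... | no i≮m  = contradiction (toℕ<n i) i≮m

sum-tabulate≡inducedSum : ∀ h E x F (g : Fin (length (mergeWith h E)) → ℕ) →
  (∀ i → g i ≡ (if incident x (lookup (mergeWith h E) i) then F (toℕ i) else 0)) →
  sum (tabulate g) ≡ inducedSum h E F x
sum-tabulate≡inducedSum h []            x F g g≗ = refl
sum-tabulate≡inducedSum h ((u , v) ∷ E) x F g g≗ =
  cong₂ _+_ (g≗ zero) (sum-tabulate≡inducedSum h E x (F ∘ suc) (g ∘ suc) (g≗ ∘ suc))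

vsum≡inducedSum : ∀ h E π x → LA.vsum (mergeWith h E) π x ≡ inducedSum h E (labelAt (mergeWith h E) π) x
vsum≡inducedSum h E π x =
  trans (cong sum (map-tabulate id summand)) (sum-tabulate≡inducedSum h E x (labelAt E′ π) summand λ i →
    cong₂ (λ b l → if b then l else 0) (incident≡ (lookup E′ i)) (sym (labelAt-toℕ E′ π i)))
  where
  E′ = mergeWith h E
  summand : Fin (length E′) → ℕ
  summand i = if LA.incident E′ x (LA.edge E′ i) then LA.label E′ π i else 0
  incident≡ : ∀ e → LA.incident E′ x e ≡ incident x e
  incident≡ (u , v) = refl

∈-rDF⁺ : ∀ {r s j a e} → j < r → a < s → e ∈ gadget j a → e ∈ rDF r s
∈-rDF⁺ {s = s} {j} j<r a<s e∈ =
  ∈-concatMap⁺ (dfEdges s) (applyUpTo⁺ id (∈-concatMap⁺ (gadget j) (applyUpTo⁺ id e∈ a<s)) j<r)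

∈-rDF⁻ : ∀ {r s e} → e ∈ rDF r s → ∃₂ λ j a → j < r × a < s × e ∈ gadget j a
∈-rDF⁻ {r} {s} e∈ with applyUpTo⁻ id (∈-concatMap⁻ (dfEdges s) {xs = upTo r} e∈)
... | j , j<r , e∈ⱼ with applyUpTo⁻ id (∈-concatMap⁻ (gadget j) {xs = upTo s} e∈ⱼ)
...   | a , a<s , e∈ⱼₐ = j , a , j<r , a<s , e∈ⱼₐ

∈-merged⁺ : ∀ h {r s j a ρ σ} → j < r → a < s → (ρ , σ) ∈ gadgetEdges →
  (h (vertex ρ j a) , h (vertex σ j a)) ∈ mergeWith h (rDF r s)
∈-merged⁺ h {j = j} {a} j<r a<s ρσ∈ =
  ∈-map⁺ _ (∈-rDF⁺ j<r a<s (∈-map⁺ (λ e → vertex (proj₁ e) j a , vertex (proj₂ e) j a) ρσ∈))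

∈-merged⁻ : ∀ h {r s e} → e ∈ mergeWith h (rDF r s) →
  ∃₂ λ j a → j < r × a < s × ∃₂ λ ρ σ → (ρ , σ) ∈ gadgetEdges × e ≡ (h (vertex ρ j a) , h (vertex σ j a))
∈-merged⁻ h e∈ with ∈-map⁻ _ e∈
... | e₀ , e₀∈ , refl with ∈-rDF⁻ e₀∈
...   | j , a , j<r , a<s , e₀∈ⱼₐ
        with ∈-map⁻ (λ (e : Role × Role) → vertex (proj₁ e) j a , vertex (proj₂ e) j a) e₀∈ⱼₐ
...     | (ρ , σ) , ρσ∈ , refl = j , a , j<r , a<s , ρ , σ , ρσ∈ , refl

∈-vertices₁ : ∀ {E : List (DV × DV)} {u v} → (u , v) ∈ E → u ∈ LA.vertices E
∈-vertices₁ uv∈ = ∈-concatMap⁺ _ (Any.map (λ { refl → here refl }) uv∈)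

∈-vertices₂ : ∀ {E : List (DV × DV)} {u v} → (u , v) ∈ E → v ∈ LA.vertices E
∈-vertices₂ uv∈ = ∈-concatMap⁺ _ (Any.map (λ { refl → there (here refl) }) uv∈)

∈-vertices⁻ : ∀ h {r s x} → x ∈ LA.vertices (mergeWith h (rDF r s)) →
  ∃ λ ρ → ∃₂ λ j a → j < r × a < s × x ≡ h (vertex ρ j a)
∈-vertices⁻ h {r} {s} x∈ with find (∈-concatMap⁻ (λ (e : DV × DV) → proj₁ e ∷ proj₂ e ∷ []) x∈)
... | e , e∈ , x∈e with ∈-merged⁻ h {r} {s} e∈
...   | j , a , j<r , a<s , ρ , σ , _ , refl with x∈e
...     | here refl         = ρ , j , a , j<r , a<s , refl
...     | there (here refl) = σ , j , a , j<r , a<s , refl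

Unique-⊆⇒length≤ : ∀ {A : Set} {xs ys : List A} → Unique xs → xs ⊆ ys → length xs ≤ length ys
Unique-⊆⇒length≤ {xs = []}     _             _     = z≤n
Unique-⊆⇒length≤ {xs = x ∷ xs} (x∉xs ∷ !xs) xs⊆ys with ∈-∃++ (xs⊆ys (here refl))
... | as , bs , refl = begin
  suc (length xs)               ≤⟨ s≤s (Unique-⊆⇒length≤ !xs xs⊆as++bs) ⟩
  suc (length (as ++ bs))       ≡⟨ cong suc (length-++ as) ⟩
  suc (length as + length bs)   ≡⟨ +-suc (length as) (length bs) ⟨
  length as + length (x ∷ bs)   ≡⟨ length-++ as ⟨
  length (as ++ x ∷ bs)         ∎
  where
  open ≤-Reasoning
  xs⊆as++bs : xs ⊆ as ++ bs
  xs⊆as++bs {v} v∈xs with ∈-++⁻ as (xs⊆ys (there v∈xs))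
  ... | inj₁ v∈as          = ∈-++⁺ˡ v∈as
  ... | inj₂ (here refl)   = contradiction refl (All.lookup x∉xs v∈xs)
  ... | inj₂ (there v∈bs)  = ∈-++⁺ʳ as v∈bs

3≤length-deduplicate : ∀ {xs : List ℕ} {a b c} → a ∈ xs → b ∈ xs → c ∈ xs → a ≢ b → a ≢ c → b ≢ c →
  3 ≤ length (deduplicate _≟_ xs)
3≤length-deduplicate a∈ b∈ c∈ a≢b a≢c b≢c =
  Unique-⊆⇒length≤ ((a≢b All.∷ a≢c All.∷ All.[]) ∷ (b≢c All.∷ All.[]) ∷ All.[] ∷ [])
    λ { (here refl) → ∈-deduplicate⁺ _≟_ a∈ ; (there (here refl)) → ∈-deduplicate⁺ _≟_ b∈
      ; (there (there (here refl))) → ∈-deduplicate⁺ _≟_ c∈ }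

length-deduplicate≤3 : ∀ {xs : List ℕ} {a b c} → (∀ {v} → v ∈ xs → v ≡ a ⊎ v ≡ b ⊎ v ≡ c) →
  length (deduplicate _≟_ xs) ≤ 3
length-deduplicate≤3 {xs} {a} {b} {c} ∈abc = Unique-⊆⇒length≤ (deduplicate-! xs) λ v∈ → case (∈-deduplicate⁻ _≟_ xs v∈)
  where
  case : ∀ {v} → v ∈ xs → v ∈ a ∷ b ∷ c ∷ []
  case v∈ with ∈abc v∈
  ... | inj₁ refl        = here refl
  ... | inj₂ (inj₁ refl) = there (here refl)
  ... | inj₂ (inj₂ refl) = there (there (here refl))

byKind : ℕ → ℕ → ℕ → Kind → ℕ
byKind c d e end    = c
byKind c d e middle = d
byKind c d e apical = e

byKind-injective : ∀ {c d e} → c ≢ d → c ≢ e → d ≢ e → ∀ {k k′} → byKind c d e k ≡ byKind c d e k′ → k ≡ k′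
byKind-injective c≢d c≢e d≢e {end}    {end}    _  = refl
byKind-injective c≢d c≢e d≢e {end}    {middle} eq = contradiction eq c≢d
byKind-injective c≢d c≢e d≢e {end}    {apical} eq = contradiction eq c≢e
byKind-injective c≢d c≢e d≢e {middle} {end}    eq = contradiction (sym eq) c≢d
byKind-injective c≢d c≢e d≢e {middle} {middle} _  = refl
byKind-injective c≢d c≢e d≢e {middle} {apical} eq = contradiction eq d≢e
byKind-injective c≢d c≢e d≢e {apical} {end}    eq = contradiction (sym eq) c≢e
byKind-injective c≢d c≢e d≢e {apical} {middle} eq = contradiction (sym eq) d≢e
byKind-injective c≢d c≢e d≢e {apical} {apical} _  = refl

module Labelled (h : DV → DV) (r s : ℕ) (π : LA.Labeling (mergeWith h (rDF r s))) where

  E : List (DV × DV)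
  E = mergeWith h (rDF r s)

  labels : ℕ → ℕ
  labels = labelAt E π

  f⁺ : DV → ℕ
  f⁺ = inducedSum h (rDF r s) labels

  roleSumAt : Role → ℕ → ℕ → ℕ
  roleSumAt ρ j a = roleSum ρ (gadgetLabels labels s j a)

  vsum≡f⁺ : ∀ x → LA.vsum E π x ≡ f⁺ x
  vsum≡f⁺ = vsum≡inducedSum h (rDF r s) π

  kindValued⇒threeColours : 0 < r → 0 < s → ∀ {c d e} → c ≢ d → c ≢ e → d ≢ e →
    (∀ ρ j a → j < r → a < s → f⁺ (h (vertex ρ j a)) ≡ byKind c d e (kind ρ)) →
    LA.IsLocalAntimagic E π × LA.colours E π ≡ 3
  kindValued⇒threeColours 0<r 0<s {c} {d} {e} c≢d c≢e d≢e value = antimagic , ≤-antisym at-most-3 at-least-3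
    where
    vsum-value : ∀ ρ j a → j < r → a < s → LA.vsum E π (h (vertex ρ j a)) ≡ byKind c d e (kind ρ)
    vsum-value ρ j a j<r a<s = trans (vsum≡f⁺ _) (value ρ j a j<r a<s)

    antimagic : LA.IsLocalAntimagic E π
    antimagic i with ∈-merged⁻ h {r} {s} (∈-lookup {xs = E} i)
    ... | j , a , j<r , a<s , ρ , σ , ρσ∈ , eᵢ≡ rewrite eᵢ≡ = λ eq →
      gadgetEdge-kinds ρσ∈ (byKind-injective c≢d c≢e d≢e
        (trans (sym (vsum-value ρ j a j<r a<s)) (trans eq (vsum-value σ j a j<r a<s))))

    at-most-3 : LA.colours E π ≤ 3
    at-most-3 = length-deduplicate≤3 λ v∈ → case (∈-map⁻ (LA.vsum E π) v∈)
      where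
      case : ∀ {v} → (∃ λ x → x ∈ LA.vertices E × v ≡ LA.vsum E π x) → v ≡ c ⊎ v ≡ d ⊎ v ≡ e
      case (x , x∈ , refl) with ∈-vertices⁻ h x∈
      ... | ρ , j , a , j<r , a<s , refl with kind ρ | vsum-value ρ j a j<r a<s
      ...   | end    | eq = inj₁ eq
      ...   | middle | eq = inj₂ (inj₁ eq)
      ...   | apical | eq = inj₂ (inj₂ eq)

    at-least-3 : 3 ≤ LA.colours E π
    at-least-3 = 3≤length-deduplicate (witness U₁ (∈-vertices₁ u₁w₁)) (witness W₁ (∈-vertices₂ u₁w₁))
                                      (witness Y (∈-vertices₁ (∈-merged⁺ h 0<r 0<s YW₁))) c≢d c≢e d≢e
      where
      u₁w₁ = ∈-merged⁺ h 0<r 0<s U₁W₁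
      witness : ∀ ρ → h (vertex ρ 0 0) ∈ LA.vertices E → byKind c d e (kind ρ) ∈ map (LA.vsum E π) (LA.vertices E)
      witness ρ x∈ = subst (_∈ _) (vsum-value ρ 0 0 0<r 0<s) (∈-map⁺ (LA.vsum E π) x∈)

-- Labellings with two colours

module TwoColoured (h : DV → DV) (r s : ℕ) (0<r : 0 < r) (0<s : 0 < s)
                   (π : LA.Labeling (mergeWith h (rDF r s)))
                   (antimagic : LA.IsLocalAntimagic (mergeWith h (rDF r s)) π)
                   (few : LA.colours (mergeWith h (rDF r s)) π < 3) where

  open Labelled h r s π public

  adjacent-distinct : ∀ {ρ σ j a} → j < r → a < s → (ρ , σ) ∈ gadgetEdges → f⁺ (h (vertex ρ j a)) ≢ f⁺ (h (vertex σ j a))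
  adjacent-distinct {ρ} {σ} {j} {a} j<r a<s ρσ∈ eq = antimagic (Any.index e∈)
    (subst (λ e → LA.vsum E π (proj₁ e) ≡ LA.vsum E π (proj₂ e)) (lookup-index e∈)
      (trans (vsum≡f⁺ _) (trans eq (sym (vsum≡f⁺ _)))))
    where e∈ = ∈-merged⁺ h {r} {s} j<r a<s ρσ∈

  α β : ℕ
  α = f⁺ (h (vertex U₁ 0 0))
  β = f⁺ (h (vertex W₁ 0 0))

  α≢β : α ≢ β
  α≢β = adjacent-distinct 0<r 0<s U₁W₁

  colour : Bool → ℕ
  colour true  = α
  colour false = β

  twoValued : ∀ {x} → x ∈ LA.vertices E → f⁺ x ≡ α ⊎ f⁺ x ≡ β
  twoValued {x} x∈ with f⁺ x ≟ α | f⁺ x ≟ β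
  ... | yes x≡α | _       = inj₁ x≡α
  ... | no _    | yes x≡β = inj₂ x≡β
  ... | no x≢α  | no x≢β  = contradiction few (≤⇒≯ (3≤length-deduplicate
          (value∈ (∈-vertices₁ u₁w₁)) (value∈ (∈-vertices₂ u₁w₁)) (value∈ x∈) α≢β (x≢α ∘ sym) (x≢β ∘ sym)))
    where
    u₁w₁ = ∈-merged⁺ h 0<r 0<s U₁W₁
    value∈ : ∀ {x} → x ∈ LA.vertices E → f⁺ x ∈ map (LA.vsum E π) (LA.vertices E)
    value∈ x∈ = subst (_∈ _) (vsum≡f⁺ _) (∈-map⁺ (LA.vsum E π) x∈)

  opposite : ∀ {x x′} b → x′ ∈ LA.vertices E → f⁺ x ≢ f⁺ x′ → f⁺ x ≡ colour b → f⁺ x′ ≡ colour (not b)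
  opposite {x′ = x′} b x′∈ x≢x′ x≡b with twoValued x′∈
  opposite true  x′∈ x≢x′ x≡b | inj₁ x′≡α = contradiction (trans x≡b (sym x′≡α)) x≢x′
  opposite false x′∈ x≢x′ x≡b | inj₁ x′≡α = x′≡α
  opposite true  x′∈ x≢x′ x≡b | inj₂ x′≡β = x′≡β
  opposite false x′∈ x≢x′ x≡b | inj₂ x′≡β = contradiction (trans x≡b (sym x′≡β)) x≢x′

  -- The side onA of gadget (j, a) gets α if o = false and β if o = true.
  Coloured : Bool → ℕ → ℕ → Set
  Coloured o j a = ∀ ρ → f⁺ (h (vertex ρ j a)) ≡ colour (onA ρ xor o)

  module _ {o : Bool} {j a : ℕ} (j<r : j < r) (a<s : a < s) where

    private
      Col : Role → Set
      Col ρ = f⁺ (h (vertex ρ j a)) ≡ colour (onA ρ xor o)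

      step : ∀ {ρ σ} → (ρ , σ) ∈ gadgetEdges → Col ρ → Col σ
      step {ρ} {σ} ρσ∈ col = subst (λ c → f⁺ (h (vertex σ j a)) ≡ colour c)
        (trans (not-distribˡ-xor (onA ρ) o) (cong (_xor o) (sym (onA-edge ρσ∈))))
        (opposite (onA ρ xor o) (∈-vertices₂ (∈-merged⁺ h j<r a<s ρσ∈)) (adjacent-distinct j<r a<s ρσ∈) col)

      step⁻ : ∀ {ρ σ} → (ρ , σ) ∈ gadgetEdges → Col σ → Col ρ
      step⁻ {ρ} {σ} ρσ∈ col = subst (λ c → f⁺ (h (vertex ρ j a)) ≡ colour c)
        (trans (cong (λ b → not (b xor o)) (onA-edge ρσ∈))
          (trans (cong not (sym (not-distribˡ-xor (onA ρ) o))) (not-involutive (onA ρ xor o))))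
        (opposite (onA σ xor o) (∈-vertices₁ (∈-merged⁺ h j<r a<s ρσ∈)) (adjacent-distinct j<r a<s ρσ∈ ∘ sym) col)

      toU₁ : ∀ ρ → Col ρ → Col U₁
      toU₁ U₁ = id
      toU₁ W₁ = step⁻ U₁W₁
      toU₁ V₁ = step⁻ U₁W₁ ∘ step⁻ W₁V₁
      toU₁ U₂ = step⁻ U₁W₁ ∘ step YW₁ ∘ step⁻ YU₂
      toU₁ W₂ = step ZU₁ ∘ step⁻ ZW₂
      toU₁ V₂ = step⁻ U₁W₁ ∘ step YW₁ ∘ step⁻ YV₂
      toU₁ Y  = step⁻ U₁W₁ ∘ step YW₁
      toU₁ Z  = step ZU₁

      fromU₁ : Col U₁ → ∀ σ → Col σ
      fromU₁ col U₁ = col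
      fromU₁ col W₁ = step U₁W₁ col
      fromU₁ col V₁ = step W₁V₁ (step U₁W₁ col)
      fromU₁ col U₂ = step YU₂ (step⁻ YW₁ (step U₁W₁ col))
      fromU₁ col W₂ = step ZW₂ (step⁻ ZU₁ col)
      fromU₁ col V₂ = step YV₂ (step⁻ YW₁ (step U₁W₁ col))
      fromU₁ col Y  = step⁻ YW₁ (step U₁W₁ col)
      fromU₁ col Z  = step⁻ ZU₁ col

    spread : ∀ ρ → f⁺ (h (vertex ρ j a)) ≡ colour (onA ρ xor o) → Coloured o j a
    spread ρ col = fromU₁ (toU₁ ρ col)

  origin : Coloured false 0 0
  origin = spread 0<r 0<s U₁ refl

representative : Kind → Role
representative end    = U₁
representative middle = W₁
representative apical = Y

representative-kind : ∀ κ → kind (representative κ) ==ᴷ κ ≡ true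
representative-kind end    = refl
representative-kind middle = refl
representative-kind apical = refl

module KindMergeLowerBound {κ h} (merges : Merges κ h) (r s : ℕ) (0<r : 0 < r) (0<s : 0 < s)
                           (π : LA.Labeling (mergeWith h (rDF r s)))
                           (antimagic : LA.IsLocalAntimagic (mergeWith h (rDF r s)) π)
                           (few : LA.colours (mergeWith h (rDF r s)) π < 3) where

  open TwoColoured h r s 0<r 0<s π antimagic few

  merges-representative : ∀ j a → h (vertex (representative κ) j a) ≡ h (vertex (representative κ) 0 a)
  merges-representative j a rewrite merges (representative κ) j a | merges (representative κ) 0 a
                                  | representative-kind κ = refl

  -- Gadgets of one component share their apex y_j; gadgets (j, 0) and (0, 0) share a merged vertex.
  allColoured : ∀ {j a} → j < r → a < s → Coloured false j a
  allColoured {j} j<r a<s = spread j<r a<s Y (component Y)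
    where
    component : Coloured false j 0
    component = spread j<r 0<s (representative κ)
      (trans (cong f⁺ (merges-representative j 0)) (origin (representative κ)))

  total : Role → ℕ
  total ρ = ∑[ j < r ] ∑[ a < s ] roleSumAt ρ j a

  classCount : Role → ℕ
  classCount ρ = classes r (kind ρ ==ᴷ κ) * classes s (isApex ρ)

  total≡ : ∀ ρ → total ρ ≡ classCount ρ * colour (onA ρ)
  total≡ ρ = trans (∑∑-classSum-const (kind ρ ==ᴷ κ) (isApex ρ) (roleSumAt ρ) 0<r 0<s λ j₀ a₀ j₀<r a₀<s →
      trans (sym (inducedSum-vertex {h} (Merges⇒Identifies {h = h} merges ρ) r s labels j₀<r a₀<s))
            (trans (allColoured j₀<r a₀<s ρ) (cong colour (xor-identityʳ (onA ρ)))))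
    (sym (*-assoc (classes r (kind ρ ==ᴷ κ)) (classes s (isApex ρ)) _))

  -- Both colour classes contain, kind by kind, the same number of vertices.
  α≡β : α ≡ β
  α≡β = *-cancelˡ-≡ α β N ⦃ >-nonZero 0<N ⦄ (begin
    N * α
      ≡⟨ distrib-A (classCount Y) (classCount U₁) (classCount W₂) α ⟩
    classCount Y * α + (classCount U₁ * α + classCount V₁ * α + classCount W₂ * α)
      ≡⟨ cong₂ _+_ (total≡ Y) (cong₂ _+_ (cong₂ _+_ (total≡ U₁) (total≡ V₁)) (total≡ W₂)) ⟨
    total Y + (total U₁ + total V₁ + total W₂)
      ≡⟨ totals-balance r s (gadgetLabels labels s) ⟩
    total Z + (total W₁ + total U₂ + total V₂)
      ≡⟨ cong₂ _+_ (total≡ Z) (cong₂ _+_ (cong₂ _+_ (total≡ W₁) (total≡ U₂)) (total≡ V₂)) ⟩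
    classCount Z * β + (classCount W₁ * β + classCount U₂ * β + classCount V₂ * β)
      ≡⟨ distrib-B (classCount Y) (classCount U₁) (classCount W₂) β ⟩
    N * β
      ∎)
    where
    open ≡-Reasoning
    N = classCount Y + (classCount U₁ + classCount V₁ + classCount W₂)
    0<N : 0 < N
    0<N = <-≤-trans (subst (0 <_) (sym (*-identityʳ _)) (classes-pos (apical ==ᴷ κ) 0<r)) (m≤m+n _ _)
    distrib-A : ∀ a e m x → (a + (e + e + m)) * x ≡ a * x + (e * x + e * x + m * x)
    distrib-A = solve-∀
    distrib-B : ∀ a e m x → a * x + (m * x + e * x + e * x) ≡ (a + (e + e + m)) * x
    distrib-B = solve-∀

  impossible : ⊥
  impossible = α≢β α≡β

∑-next-odd : ∀ {r t} (f : ℕ → ℕ) → r ≡ t + t → 0 < t → ∑[ i < t ] f (next r (suc (i + i))) ≡ ∑[ i < t ] f (i + i)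
∑-next-odd {r} {suc t} f r≡ _ = begin
  ∑[ i < suc t ] f (next r (suc (i + i)))                 ≡⟨ ∑-init-last t _ ⟩
  ∑[ i < t ] f (next r (suc (i + i))) + f (next r (suc (t + t)))
    ≡⟨ cong₂ _+_ (∑-cong t λ i i<t → cong f (trans (next-suc (inner i<t)) (cong suc (sym (+-suc i i)))))
                 (cong f (next-last (sym (trans r≡ (cong suc (+-suc t t)))))) ⟩
  ∑[ i < t ] f (suc i + suc i) + f 0                       ≡⟨ +-comm _ (f 0) ⟩
  ∑[ i < suc t ] f (i + i)                                 ∎
  where
  open ≡-Reasoning
  inner : ∀ {i} → i < t → suc (suc (i + i)) < r
  inner {i} i<t = subst (suc (suc (i + i)) <_) (sym (trans r≡ (cong suc (+-suc t t)))) (s<s (s<s (+-mono-< i<t i<t)))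

pair-identity : ∀ P₀ Q₀ Y₀ Z₀ P₁ Q₁ Y₁ Z₁ Zₙ → Y₀ + P₀ ≡ Z₀ + Q₀ → Y₁ + P₁ ≡ Z₁ + Q₁ →
  P₀ + (Y₀ + Z₁) + Q₁ + Zₙ ≡ Q₀ + (Y₁ + Zₙ) + P₁ + Z₀
pair-identity P₀ Q₀ Y₀ Z₀ P₁ Q₁ Y₁ Z₁ Zₙ balance₀ balance₁ = begin
  P₀ + (Y₀ + Z₁) + Q₁ + Zₙ     ≡⟨ regroupˡ P₀ Y₀ Z₁ Q₁ Zₙ ⟩
  (Y₀ + P₀) + (Z₁ + Q₁) + Zₙ   ≡⟨ cong₂ (λ u v → u + v + Zₙ) balance₀ (sym balance₁) ⟩
  (Z₀ + Q₀) + (Y₁ + P₁) + Zₙ   ≡⟨ regroupʳ Z₀ Q₀ Y₁ P₁ Zₙ ⟩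
  Q₀ + (Y₁ + Zₙ) + P₁ + Z₀     ∎
  where
  open ≡-Reasoning
  regroupˡ : ∀ p y z q n → p + (y + z) + q + n ≡ (y + p) + (z + q) + n
  regroupˡ = solve-∀
  regroupʳ : ∀ z q y p n → (z + q) + (y + p) + n ≡ q + (y + n) + p + z
  regroupʳ = solve-∀

s[x+x+x]+x+s[x+x+x]≡[1+6s]x : ∀ s x → s * (x + x + x) + x + s * (x + x + x) ≡ suc (6 * s) * x
s[x+x+x]+x+s[x+x+x]≡[1+6s]x = solve-∀

module CyclicLowerBound (r s t : ℕ) (r≡t+t : r ≡ t + t) (0<t : 0 < t) (0<s : 0 < s)
                        (π : LA.Labeling (DF4 r s)) (antimagic : LA.IsLocalAntimagic (DF4 r s) π)
                        (few : LA.colours (DF4 r s) π < 3) where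

  0<r : 0 < r
  0<r = subst (0 <_) (sym r≡t+t) (<-≤-trans 0<t (m≤m+n t t))

  open TwoColoured (merge4 r) r s 0<r 0<s π antimagic few

  -- Along the cycle of components, y_j = z_(j+1) forces the orientation to alternate.
  advance : ∀ {o j} → j < r → Coloured o j 0 → ∀ {a} → a < s → Coloured (not o) (next r j) a
  advance j<r coloured a<s = spread (next<r j<r) a<s Z (coloured Y)

  even<r : ∀ {i} → i < t → i + i < r
  even<r {i} i<t = subst (i + i <_) (sym r≡t+t) (+-mono-< i<t i<t)

  odd<r : ∀ {i} → i < t → suc (i + i) < r
  odd<r {i} i<t = subst (suc (i + i) <_) (sym r≡t+t) (subst (_≤ t + t) (cong suc (+-suc i i)) (+-mono-≤ i<t i<t))

  next-even : ∀ {i} → i < t → next r (i + i) ≡ suc (i + i)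
  next-even i<t = next-suc (odd<r i<t)

  next-odd : ∀ {i} → suc i < t → next r (suc (i + i)) ≡ suc i + suc i
  next-odd {i} 1+i<t = trans (next-suc (subst (_< r) (cong suc (+-suc i i)) (even<r 1+i<t))) (cong suc (sym (+-suc i i)))

  colouredPair : ∀ {i} → i < t → (∀ {a} → a < s → Coloured false (i + i) a) × (∀ {a} → a < s → Coloured true (suc (i + i)) a)
  colouredPair {zero} 0<t = even , odd
    where
    even : ∀ {a} → a < s → Coloured false 0 a
    even a<s = spread 0<r a<s Z (origin Z)
    odd : ∀ {a} → a < s → Coloured true 1 a
    odd a<s = subst (λ j → Coloured true j _) (next-even 0<t) (advance 0<r (even 0<s) a<s)
  colouredPair {suc i} 1+i<t = even , odd
    where
    i<t = <-trans (n<1+n i) 1+i<t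
    even : ∀ {a} → a < s → Coloured false (suc i + suc i) a
    even a<s = subst (λ j → Coloured false j _) (next-odd 1+i<t) (advance (odd<r i<t) (proj₂ (colouredPair i<t) 0<s) a<s)
    odd : ∀ {a} → a < s → Coloured true (suc (suc i + suc i)) a
    odd a<s = subst (λ j → Coloured true j _) (next-even 1+i<t) (advance (even<r 1+i<t) (even 0<s) a<s)

  pathValue : ∀ {i k j a} → j < r → a < s → f⁺ (vertex (path i k) j a) ≡ roleSumAt (path i k) j a
  pathValue {i} {k} = inducedSum-merge4-path r s labels i k

  P Q Yc Zc : ℕ → ℕ
  P  j = ∑[ a < s ] (roleSumAt U₁ j a + roleSumAt V₁ j a + roleSumAt W₂ j a)
  Q  j = ∑[ a < s ] (roleSumAt W₁ j a + roleSumAt U₂ j a + roleSumAt V₂ j a)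
  Yc j = ∑[ a < s ] roleSumAt Y j a
  Zc j = ∑[ a < s ] roleSumAt Z j a

  component-balance : ∀ j → Yc j + P j ≡ Zc j + Q j
  component-balance j = trans (sym (∑-distrib-+ s _ _))
    (trans (∑-cong s λ a _ → gadget-balance (gadgetLabels labels s j a)) (∑-distrib-+ s _ _))

  hubValue : ∀ {j} → j < r → f⁺ (z j) ≡ Yc (prev r j) + Zc j
  hubValue = inducedSum-hub r s labels

  module _ {o : Bool} {j : ℕ} (j<r : j < r) (coloured : ∀ {a} → a < s → Coloured o j a) where

    P≡ : P j ≡ s * (colour (not o) + colour (not o) + colour (not o))
    P≡ = ∑-const s _ λ a a<s → cong₂ _+_ (cong₂ _+_ (trans (sym (pathValue j<r a<s)) (coloured a<s U₁))
                                                     (trans (sym (pathValue j<r a<s)) (coloured a<s V₁)))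
                                         (trans (sym (pathValue j<r a<s)) (coloured a<s W₂))

    Q≡ : Q j ≡ s * (colour o + colour o + colour o)
    Q≡ = ∑-const s _ λ a a<s → cong₂ _+_ (cong₂ _+_ (trans (sym (pathValue j<r a<s)) (coloured a<s W₁))
                                                     (trans (sym (pathValue j<r a<s)) (coloured a<s U₂)))
                                         (trans (sym (pathValue j<r a<s)) (coloured a<s V₂))

    hub≡ : f⁺ (z j) ≡ colour o
    hub≡ = coloured 0<s Z

  weight : ℕ
  weight = suc (6 * s)

  collect : ∀ x → s * (x + x + x) + x + s * (x + x + x) ≡ weight * x
  collect = s[x+x+x]+x+s[x+x+x]≡[1+6s]x s

  -- Components 2i and 2i+1 with the hub z_(2i+1) between them, and with the next hub z_(2i+2):
  -- pairA i gathers vertices coloured α, pairB i vertices coloured β.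
  pairA pairB : ℕ → ℕ
  pairA i = P (i + i) + f⁺ (z (suc (i + i))) + Q (suc (i + i))
  pairB i = Q (i + i) + f⁺ (z (next r (suc (i + i)))) + P (suc (i + i))

  pairA≡ : ∀ {i} → i < t → pairA i ≡ weight * α
  pairA≡ i<t with colouredPair i<t
  ... | even , odd = trans (cong₂ _+_ (cong₂ _+_ (P≡ (even<r i<t) even) (hub≡ (odd<r i<t) odd)) (Q≡ (odd<r i<t) odd))
                           (collect α)

  pairB≡ : ∀ {i} → i < t → pairB i ≡ weight * β
  pairB≡ {i} i<t with colouredPair i<t
  ... | even , odd = trans (cong₂ _+_ (cong₂ _+_ (Q≡ (even<r i<t) even) (hub≡ (next<r (odd<r i<t)) following))
                                      (P≡ (odd<r i<t) odd))
                           (collect β)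
    where
    following : ∀ {a} → a < s → Coloured false (next r (suc (i + i))) a
    following = advance (odd<r i<t) (odd 0<s)

  pair-balance : ∀ {i} → i < t → pairA i + Zc (next r (suc (i + i))) ≡ pairB i + Zc (i + i)
  pair-balance {i} i<t = begin
    pairA i + Zc n
      ≡⟨ cong (λ v → P e + v + Q d + Zc n) (hubValue (odd<r i<t)) ⟩
    P e + (Yc e + Zc d) + Q d + Zc n
      ≡⟨ pair-identity (P e) (Q e) (Yc e) (Zc e) (P d) (Q d) (Yc d) (Zc d) (Zc n)
                       (component-balance e) (component-balance d) ⟩
    Q e + (Yc d + Zc n) + P d + Zc e
      ≡⟨ cong (λ v → Q e + v + P d + Zc e)
              (trans (cong (λ j → Yc j + Zc n) (sym (prev-next (odd<r i<t)))) (sym (hubValue (next<r (odd<r i<t))))) ⟩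
    pairB i + Zc e
      ∎
    where
    open ≡-Reasoning
    e = i + i
    d = suc e
    n = next r d

  α≡β : α ≡ β
  α≡β = *-cancelˡ-≡ α β weight (*-cancelˡ-≡ _ _ t ⦃ >-nonZero 0<t ⦄ (begin
    t * (weight * α)                         ≡⟨ ∑-const t _ (λ i → pairA≡) ⟨
    ∑[ i < t ] pairA i                       ≡⟨ +-cancelʳ-≡ _ _ _ (begin
      ∑[ i < t ] pairA i + ∑[ i < t ] Zc (i + i)
        ≡⟨ cong (∑ t pairA +_) (∑-next-odd Zc r≡t+t 0<t) ⟨
      ∑[ i < t ] pairA i + ∑[ i < t ] Zc (next r (suc (i + i)))
        ≡⟨ ∑-distrib-+ t _ _ ⟨
      ∑[ i < t ] (pairA i + Zc (next r (suc (i + i))))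
        ≡⟨ ∑-cong t (λ i → pair-balance) ⟩
      ∑[ i < t ] (pairB i + Zc (i + i))
        ≡⟨ ∑-distrib-+ t _ _ ⟩
      ∑[ i < t ] pairB i + ∑[ i < t ] Zc (i + i)
        ∎) ⟩
    ∑[ i < t ] pairB i                       ≡⟨ ∑-const t _ (λ i → pairB≡) ⟩
    t * (weight * β)                         ∎))
    where open ≡-Reasoning

  impossible : ⊥
  impossible = α≢β α≡β

-- The explicit labelling

Fin-injective⇒surjective : ∀ {m} (f : Fin m → Fin m) → (∀ {x y} → f x ≡ f y → x ≡ y) → ∀ y → ∃ λ x → f x ≡ y
Fin-injective⇒surjective {suc m} f f-inj y with any? (λ x → f x Fin.≟ y)
... | yes hit = hit
... | no miss = contradiction (injective⇒≤ {f = f′} f′-inj) (<-irrefl refl)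
  where
  f≢y : ∀ x → y ≢ f x
  f≢y x y≡fx = miss (x , sym y≡fx)
  f′ : Fin (suc m) → Fin m
  f′ x = punchOut (f≢y x)
  f′-inj : ∀ {x x′} → f′ x ≡ f′ x′ → x ≡ x′
  f′-inj {x} {x′} eq = f-inj (punchOut-injective (f≢y x) (f≢y x′) eq)

abstract
  onto⇒permutation : ∀ m (g : ℕ → ℕ) → (∀ v → v < m → ∃ λ i → i < m × g i ≡ v) →
    Σ (Permutation′ m) λ π → ∀ i → toℕ (π ⟨$⟩ʳ i) ≡ g (toℕ i)
  onto⇒permutation m g onto = permutation σ τ σ∘τ τ∘σ , g∘τ∘σ
    where
    τ : Fin m → Fin m
    τ v = fromℕ< (proj₁ (proj₂ (onto (toℕ v) (toℕ<n v))))
    g∘τ : ∀ v → g (toℕ (τ v)) ≡ toℕ v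
    g∘τ v = trans (cong g (toℕ-fromℕ< _)) (proj₂ (proj₂ (onto (toℕ v) (toℕ<n v))))
    τ-inj : ∀ {v v′} → τ v ≡ τ v′ → v ≡ v′
    τ-inj {v} {v′} eq = toℕ-injective (trans (sym (g∘τ v)) (trans (cong (g ∘ toℕ) eq) (g∘τ v′)))
    σ : Fin m → Fin m
    σ i = proj₁ (Fin-injective⇒surjective τ τ-inj i)
    τ∘σ : ∀ i → τ (σ i) ≡ i
    τ∘σ i = proj₂ (Fin-injective⇒surjective τ τ-inj i)
    σ∘τ : ∀ v → σ (τ v) ≡ v
    σ∘τ v = τ-inj (τ∘σ (τ v))
    g∘τ∘σ : ∀ i → toℕ (σ i) ≡ g (toℕ i)
    g∘τ∘σ i = trans (sym (g∘τ (σ i))) (cong (g ∘ toℕ) (τ∘σ i))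

-- One less than the labels of the ten edges of the q-th gadget (in the order of gadgetEdges),
-- where p′ = n − 1 − q.  Each k contributes one label to a block [c n, (c + 1) n), except that
-- k = 0, 5 and k = 2, 7 interleave in the blocks [n, 3n) and [5n, 7n).
labelWith : ℕ → ℕ → ℕ → ℕ → ℕ
labelWith n q p′ 0 = n + 2 * q
labelWith n q p′ 1 = 3 * n + p′
labelWith n q p′ 2 = 5 * n + 2 * p′
labelWith n q p′ 3 = q
labelWith n q p′ 4 = 9 * n + p′
labelWith n q p′ 5 = n + 2 * q + 1
labelWith n q p′ 6 = 7 * n + p′
labelWith n q p′ 7 = 5 * n + 2 * p′ + 1
labelWith n q p′ 8 = 4 * n + q
labelWith n q p′ 9 = 8 * n + q
labelWith n q p′ _ = 0

label : ℕ → ℕ → ℕ → ℕ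
label n q = labelWith n q (n ∸ suc q)

-- One less than the label of the i-th edge of r DF(2s) or of a merge of it, n = r s.
labelTable : ℕ → ℕ → ℕ
labelTable n i = label n (i / 10) (i % 10)

labelTable-position : ∀ n q {k} → k < 10 → labelTable n (k + q * 10) ≡ label n q k
labelTable-position n q {k} k<10 = cong₂ (label n) quotient remainder
  where
  quotient : (k + q * 10) / 10 ≡ q
  quotient = trans (+-distrib-/-∣ʳ k (divides-refl q)) (cong₂ _+_ (m<n⇒m/n≡0 k<10) (m*n/n≡m q 10))
  remainder : (k + q * 10) % 10 ≡ k
  remainder = trans ([m+kn]%n≡m%n k q 10) (m<n⇒m%n≡m k<10)

Taken : ℕ → ℕ → Set
Taken n v = ∃₂ λ q k → q < n × k < 10 × label n q k ≡ v

taken-p : ∀ {n p′} k → p′ < n → k < 10 → Taken n (labelWith n (n ∸ suc p′) p′ k)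
taken-p {suc n} {p′} k (s≤s p′≤n) k<10 =
  n ∸ p′ , k , s≤s (m∸n≤m n p′) , k<10 , cong (λ x → labelWith (suc n) (n ∸ p′) x k) (m∸[m∸n]≡n p′≤n)

halves : ∀ w → w ≡ 2 * (w / 2) ⊎ w ≡ 2 * (w / 2) + 1
halves w with w % 2 | m%n<n w 2 | m≡m%n+[m/n]*n w 2
... | 0 | _           | w≡ = inj₁ (trans w≡ (*-comm (w / 2) 2))
... | 1 | _           | w≡ = inj₂ (trans w≡ (trans (+-comm 1 (w / 2 * 2)) (cong (_+ 1) (*-comm (w / 2) 2))))
... | suc (suc _) | s<s (s<s ()) | _

taken-pair₁ : ∀ {n w} → w < n * 2 → Taken n (n + w)
taken-pair₁ {n} {w} w<2n with halves w
... | inj₁ w≡ = w / 2 , 0 , m<n*o⇒m/o<n w<2n , z<s , cong (n +_) (sym w≡)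
... | inj₂ w≡ = w / 2 , 5 , m<n*o⇒m/o<n w<2n , <ᵇ⇒< 5 10 _ , trans (+-assoc n _ 1) (cong (n +_) (sym w≡))

taken-pair₅ : ∀ {n w} → w < n * 2 → Taken n (5 * n + w)
taken-pair₅ {n} {w} w<2n with halves w
... | inj₁ w≡ = subst (Taken n) (cong (5 * n +_) (sym w≡)) (taken-p 2 (m<n*o⇒m/o<n w<2n) (<ᵇ⇒< 2 10 _))
... | inj₂ w≡ = subst (Taken n) (trans (+-assoc (5 * n) _ 1) (cong (5 * n +_) (sym w≡)))
                     (taken-p 7 (m<n*o⇒m/o<n w<2n) (<ᵇ⇒< 7 10 _))

private
  1*n+o≡n+o : ∀ n o → 1 * n + o ≡ n + o
  1*n+o≡n+o = solve-∀
  2*n+o≡n+[n+o] : ∀ n o → 2 * n + o ≡ n + (n + o)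
  2*n+o≡n+[n+o] = solve-∀
  6*n+o≡5*n+[n+o] : ∀ n o → 6 * n + o ≡ 5 * n + (n + o)
  6*n+o≡5*n+[n+o] = solve-∀
  n+n≡n*2 : ∀ n → n + n ≡ n * 2
  n+n≡n*2 = solve-∀

taken-block : ∀ {n o} c → c < 10 → o < n → Taken n (c * n + o)
taken-block {n} {o} 0 _ o<n = o , 3 , o<n , <ᵇ⇒< 3 10 _ , refl
taken-block {n} {o} 1 _ o<n = subst (Taken n) (sym (1*n+o≡n+o n o)) (taken-pair₁ (<-≤-trans o<n (m≤m*n n 2)))
taken-block {n} {o} 2 _ o<n =
  subst (Taken n) (sym (2*n+o≡n+[n+o] n o)) (taken-pair₁ (subst (n + o <_) (n+n≡n*2 n) (+-monoʳ-< n o<n)))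
taken-block {n} {o} 3 _ o<n = taken-p 1 o<n (<ᵇ⇒< 1 10 _)
taken-block {n} {o} 4 _ o<n = o , 8 , o<n , <ᵇ⇒< 8 10 _ , refl
taken-block {n} {o} 5 _ o<n = taken-pair₅ (<-≤-trans o<n (m≤m*n n 2))
taken-block {n} {o} 6 _ o<n =
  subst (Taken n) (sym (6*n+o≡5*n+[n+o] n o)) (taken-pair₅ (subst (n + o <_) (n+n≡n*2 n) (+-monoʳ-< n o<n)))
taken-block {n} {o} 7 _ o<n = taken-p 6 o<n (<ᵇ⇒< 6 10 _)
taken-block {n} {o} 8 _ o<n = o , 9 , o<n , <ᵇ⇒< 9 10 _ , refl
taken-block {n} {o} 9 _ o<n = taken-p 4 o<n (<ᵇ⇒< 4 10 _)
taken-block (suc (suc (suc (suc (suc (suc (suc (suc (suc (suc c)))))))))) c<10 _ = contradiction c<10 (m+n≮m 10 c)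

labelTable-onto : ∀ n v → v < n * 10 → ∃ λ i → i < n * 10 × labelTable n i ≡ v
labelTable-onto n@(suc _) v v<10n
  with taken-block (v / n) (m<n*o⇒m/o<n (subst (v <_) (*-comm n 10) v<10n)) (m%n<n v n)
... | q , k , q<n , k<10 , labelq≡ =
  k + q * 10 , position<10n ,
  trans (labelTable-position n q k<10) (trans labelq≡ (trans (+-comm _ (v % n)) (sym (m≡m%n+[m/n]*n v n))))
  where
  position<10n : k + q * 10 < n * 10
  position<10n = <-≤-trans (+-monoˡ-< (q * 10) k<10) (*-monoˡ-≤ 10 q<n)

0<m*n : ∀ {m n} → 0 < m → 0 < n → 0 < m * n
0<m*n {suc m} {suc n} _ _ = z<s

baseValue : ℕ → Kind → ℕ
baseValue n = byKind (suc (8 * n)) (suc (15 * n)) (2 + 19 * n)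

end<middle : ∀ {n} → 0 < n → baseValue n end < baseValue n middle
end<middle {n} 0<n = s<s (*-monoˡ-< n ⦃ >-nonZero 0<n ⦄ (<ᵇ⇒< 8 15 _))

middle<apical : ∀ n → baseValue n middle < baseValue n apical
middle<apical n = s<s (s≤s (*-monoˡ-≤ n (≤ᵇ⇒≤ 15 19 _)))

middle<2*end : ∀ n → baseValue n middle < 2 * baseValue n end
middle<2*end n = subst (baseValue n middle <_) (sym (2*[1+8n] n)) (s<s (s≤s (*-monoˡ-≤ n (≤ᵇ⇒≤ 15 16 _))))
  where
  2*[1+8n] : ∀ n → 2 * suc (8 * n) ≡ suc (suc (16 * n))
  2*[1+8n] = solve-∀

roleSum-labelWith : ∀ q p′ ρ → let n = suc (q + p′) in
  roleSum ρ (λ k → suc (labelWith n q p′ k)) ≡ baseValue n (kind ρ)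
roleSum-labelWith q p′ U₁ = u₁ q p′
  where
  u₁ : ∀ q p′ → let n = suc (q + p′) in suc (n + 2 * q) + suc (5 * n + 2 * p′ + 1) ≡ suc (8 * n)
  u₁ = solve-∀
roleSum-labelWith q p′ W₁ = w₁ q p′
  where
  w₁ : ∀ q p′ → let n = suc (q + p′) in suc (n + 2 * q) + suc (3 * n + p′) + suc (9 * n + p′) ≡ suc (15 * n)
  w₁ = solve-∀
roleSum-labelWith q p′ V₁ = v₁ q p′
  where
  v₁ : ∀ q p′ → let n = suc (q + p′) in suc (3 * n + p′) + suc (4 * n + q) ≡ suc (8 * n)
  v₁ = solve-∀
roleSum-labelWith q p′ U₂ = u₂ q p′
  where
  u₂ : ∀ q p′ → let n = suc (q + p′) in suc (5 * n + 2 * p′) + suc (n + 2 * q + 1) ≡ suc (8 * n)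
  u₂ = solve-∀
roleSum-labelWith q p′ W₂ = w₂ q p′
  where
  w₂ : ∀ q p′ → let n = suc (q + p′) in suc (5 * n + 2 * p′) + suc q + suc (8 * n + q) ≡ suc (15 * n)
  w₂ = solve-∀
roleSum-labelWith q p′ V₂ = v₂ q p′
  where
  v₂ : ∀ q p′ → let n = suc (q + p′) in suc q + suc (7 * n + p′) ≡ suc (8 * n)
  v₂ = solve-∀
roleSum-labelWith q p′ Y = y′ q p′
  where
  y′ : ∀ q p′ → let n = suc (q + p′) in suc (9 * n + p′) + suc (n + 2 * q + 1) + suc (7 * n + p′) ≡ 2 + 19 * n
  y′ = solve-∀
roleSum-labelWith q p′ Z = z′ q p′
  where
  z′ : ∀ q p′ → let n = suc (q + p′) in suc (5 * n + 2 * p′ + 1) + suc (4 * n + q) + suc (8 * n + q) ≡ 2 + 19 * n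
  z′ = solve-∀

roleSum-label : ∀ {n q} → q < n → ∀ ρ → roleSum ρ (λ k → suc (label n q k)) ≡ baseValue n (kind ρ)
roleSum-label {n} {q} q<n ρ = subst (λ m → roleSum ρ (λ k → suc (labelWith m q (n ∸ suc q) k)) ≡ baseValue m (kind ρ))
                                    (m+[n∸m]≡n q<n) (roleSum-labelWith q (n ∸ suc q) ρ)

module ExplicitLabelling (h : DV → DV) (r s : ℕ) where

  n m : ℕ
  n = r * s
  m = length (mergeWith h (rDF r s))

  m≡n*10 : m ≡ n * 10
  m≡n*10 = trans (length-map _ (rDF r s)) (trans (length-rDF r s) (sym (*-assoc r s 10)))

  onto : ∀ v → v < m → ∃ λ i → i < m × labelTable n i ≡ v
  onto v v<m with labelTable-onto n v (subst (v <_) m≡n*10 v<m)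
  ... | i , i<10n , labelᵢ≡v = i , subst (i <_) (sym m≡n*10) i<10n , labelᵢ≡v

  permutation-π : Σ (Permutation′ m) λ π → ∀ i → toℕ (π ⟨$⟩ʳ i) ≡ labelTable n (toℕ i)
  permutation-π = onto⇒permutation m (labelTable n) onto

  π : LA.Labeling (mergeWith h (rDF r s))
  π = proj₁ permutation-π

  open Labelled h r s π public

  labels-π : ∀ {i} → i < m → labels i ≡ suc (labelTable n i)
  labels-π {i} i<m with i <? m
  ... | yes i<m′ = cong suc (trans (proj₂ permutation-π (fromℕ< i<m′)) (cong (labelTable n) (toℕ-fromℕ< i<m′)))
  ... | no i≮m   = contradiction i<m i≮m

  roleSumAt-π : ∀ {j a} → j < r → a < s → ∀ ρ → roleSumAt ρ j a ≡ baseValue n (kind ρ)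
  roleSumAt-π {j} {a} j<r a<s ρ = trans (roleSum-cong ρ λ k → trans (labels-π (position<m k))
      (cong suc (trans (cong (labelTable n) (position≡ (toℕ k))) (labelTable-position n (j * s + a) (toℕ<n k)))))
    (roleSum-label q<n ρ)
    where
    q<n : j * s + a < n
    q<n = <-≤-trans (+-monoʳ-< (j * s) a<s) (subst (_≤ n) (+-comm s (j * s)) (*-monoˡ-≤ s j<r))
    reorder : ∀ j s a k → j * (s * 10) + (a * 10 + k) ≡ k + (j * s + a) * 10
    reorder = solve-∀
    position≡ : ∀ k → j * (s * 10) + (a * 10 + k) ≡ k + (j * s + a) * 10
    position≡ = reorder j s a
    position<m : ∀ (k : Fin 10) → j * (s * 10) + (a * 10 + toℕ k) < m
    position<m k = subst₂ _<_ (sym (position≡ (toℕ k))) (sym m≡n*10)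
      (<-≤-trans (+-monoˡ-< ((j * s + a) * 10) (toℕ<n k)) (*-monoˡ-≤ 10 q<n))

-- The four merged graphs

-- With the explicit labelling, a vertex of kind k merges copies r (k == κ) · copies s (k == apical)
-- gadget vertices, each with sum baseValue n k.
kindMerge-χla≡3 : ∀ {κ h} → Merges κ h → ∀ {r s} → 0 < r → 0 < s → ∀ {c d e} → c ≢ d → c ≢ e → d ≢ e →
  (∀ k → copies r (k ==ᴷ κ) * (copies s (k ==ᴷ apical) * baseValue (r * s) k) ≡ byKind c d e k) →
  χla≡ (mergeWith h (rDF r s)) 3
kindMerge-χla≡3 {κ} {h} merges {r} {s} 0<r 0<s {c} {d} {e} c≢d c≢e d≢e values =
  (π , kindValued⇒threeColours 0<r 0<s c≢d c≢e d≢e value) ,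
  λ π′ antimagic → ≮⇒≥ (KindMergeLowerBound.impossible merges r s 0<r 0<s π′ antimagic)
  where
  open ExplicitLabelling h r s
  value : ∀ ρ j a → j < r → a < s → f⁺ (h (vertex ρ j a)) ≡ byKind c d e (kind ρ)
  value ρ j a j<r a<s = begin
    f⁺ (h (vertex ρ j a))
      ≡⟨ inducedSum-vertex {h} (Merges⇒Identifies {h = h} merges ρ) r s labels j<r a<s ⟩
    classSum r (kind ρ ==ᴷ κ) (λ j′ → classSum s (isApex ρ) (roleSumAt ρ j′) a) j
      ≡⟨ classSum-const (kind ρ ==ᴷ κ)
           (λ j′ j′<r → classSum-const (isApex ρ) (λ a′ a′<s → roleSumAt-π j′<r a′<s ρ) a<s) j<r ⟩
    copies r (kind ρ ==ᴷ κ) * (copies s (isApex ρ) * baseValue n (kind ρ))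
      ≡⟨ cong (λ b → copies r (kind ρ ==ᴷ κ) * (copies s b * baseValue n (kind ρ))) (isApex≡ ρ) ⟩
    copies r (kind ρ ==ᴷ κ) * (copies s (kind ρ ==ᴷ apical) * baseValue n (kind ρ))
      ≡⟨ values (kind ρ) ⟩
    byKind c d e (kind ρ)
      ∎
    where open ≡-Reasoning

cyclic-χla≡3 : ∀ {r s t} → r ≡ t + t → 0 < t → 0 < s → χla≡ (DF4 r s) 3
cyclic-χla≡3 {r} {s} {t} r≡t+t 0<t 0<s =
  (π , kindValued⇒threeColours 0<r 0<s (<⇒≢ c<d) (<⇒≢ (<-trans c<d d<e)) (<⇒≢ d<e) value) ,
  λ π′ antimagic → ≮⇒≥ (CyclicLowerBound.impossible r s t r≡t+t 0<t 0<s π′ antimagic)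
  where
  open ExplicitLabelling (merge4 r) r s
  0<r : 0 < r
  0<r = subst (0 <_) (sym r≡t+t) (<-≤-trans 0<t (m≤m+n t t))
  c d e : ℕ
  c = baseValue n end
  d = baseValue n middle
  e = s * baseValue n apical + s * baseValue n apical
  c<d : c < d
  c<d = end<middle (0<m*n 0<r 0<s)
  d<e : d < e
  d<e = <-≤-trans (middle<apical n) (≤-trans (m≤n*m _ s ⦃ >-nonZero 0<s ⦄) (m≤m+n _ _))
  hubs : ∀ {j} → j < r → f⁺ (z j) ≡ e
  hubs j<r = trans (inducedSum-hub r s labels j<r)
    (cong₂ _+_ (∑-const s _ λ a a<s → roleSumAt-π (prev<r j<r) a<s Y) (∑-const s _ λ a a<s → roleSumAt-π j<r a<s Z))
  pathKind : ∀ i k → baseValue n (kind (path i k)) ≡ byKind c d e (kind (path i k))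
  pathKind i zero                = refl
  pathKind i (suc zero)          = refl
  pathKind i (suc (suc zero))    = refl
  value : ∀ ρ j a → j < r → a < s → f⁺ (merge4 r (vertex ρ j a)) ≡ byKind c d e (kind ρ)
  value (path i k) j a j<r a<s =
    trans (inducedSum-merge4-path r s labels i k j<r a<s) (trans (roleSumAt-π j<r a<s (path i k)) (pathKind i k))
  value Y j a j<r a<s = hubs (next<r j<r)
  value Z j a j<r a<s = hubs j<r

r·middle≢s·apical : ∀ r s → 2 ∣ s → ¬ 4 ∣ r * s → r * baseValue (r * s) middle ≢ s * baseValue (r * s) apical
r·middle≢s·apical r s 2∣s 4∤rs r·d≡s·e = 4∤rs (*-pres-∣ 2∣r 2∣s)
  where
  n = r * s
  2∣r·15n : 2 ∣ r * (15 * n)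
  2∣r·15n = ∣n⇒∣m*n r (∣n⇒∣m*n 15 (∣n⇒∣m*n r 2∣s))
  2∣r·15n+r : 2 ∣ r * (15 * n) + r
  2∣r·15n+r = subst (2 ∣_) (trans (sym r·d≡s·e) (trans (*-suc r (15 * n)) (+-comm r _))) (∣m⇒∣m*n _ 2∣s)
  2∣r : 2 ∣ r
  2∣r = ∣m+n∣m⇒∣n 2∣r·15n+r 2∣r·15n

r·end≢s·apical : ∀ r s → 2 ∣ s → ¬ 4 ∣ r → r * baseValue (r * s) end ≢ s * baseValue (r * s) apical
r·end≢s·apical r s 2∣s 4∤r r·c≡s·e = 4∤r (∣m+n∣m⇒∣n 4∣r·8n+r 4∣r·8n)
  where
  n = r * s
  4∣s·e : 4 ∣ s * (2 + 19 * n)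
  4∣s·e = *-pres-∣ 2∣s (∣m∣n⇒∣m+n ∣-refl (∣n⇒∣m*n 19 (∣n⇒∣m*n r 2∣s)))
  4∣r·8n : 4 ∣ r * (8 * n)
  4∣r·8n = ∣n⇒∣m*n r (∣m⇒∣m*n n (divides 2 refl))
  4∣r·8n+r : 4 ∣ r * (8 * n) + r
  4∣r·8n+r = subst (4 ∣_) (trans (sym r·c≡s·e) (trans (*-suc r (8 * n)) (+-comm r _))) 4∣s·e

m<n⇒m≢o*n : ∀ {m n o} → m < n → 0 < o → m ≢ o * n
m<n⇒m≢o*n {n = n} {o} m<n 0<o = <⇒≢ (<-≤-trans m<n (m≤n*m n o ⦃ >-nonZero 0<o ⦄))

DF1-χla≡3 : ∀ {r s} → 2 ≤ r → 0 < s → 2 ∣ s → ¬ 4 ∣ r * s → χla≡ (DF1 r s) 3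
DF1-χla≡3 {r} {s} 2≤r 0<s 2∣s 4∤rs = kindMerge-χla≡3 merge1-merges 0<r 0<s
  (m<n⇒m≢o*n (end<middle 0<n) 0<r) (m<n⇒m≢o*n (<-trans (end<middle 0<n) (middle<apical n)) 0<s)
  (r·middle≢s·apical r s 2∣s 4∤rs)
  λ { end → trans (*-identityˡ _) (*-identityˡ _) ; middle → cong (r *_) (*-identityˡ _) ; apical → *-identityˡ _ }
  where
  n = r * s
  0<r = <-trans z<s 2≤r
  0<n = 0<m*n 0<r 0<s

DF2-χla≡3 : ∀ {r s} → 2 ≤ r → 0 < s → 2 ∣ s → ¬ 4 ∣ r → χla≡ (DF2 r s) 3
DF2-χla≡3 {r} {s} 2≤r 0<s 2∣s 4∤r = kindMerge-χla≡3 merge2-merges 0<r 0<s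
  (≢-sym (<⇒≢ (<-≤-trans (middle<2*end n) (*-monoˡ-≤ (baseValue n end) 2≤r)))) (r·end≢s·apical r s 2∣s 4∤r)
  (m<n⇒m≢o*n (middle<apical n) 0<s)
  λ { end → cong (r *_) (*-identityˡ _) ; middle → trans (*-identityˡ _) (*-identityˡ _) ; apical → *-identityˡ _ }
  where
  n = r * s
  0<r = <-trans z<s 2≤r

DF3-χla≡3 : ∀ {r s} → 2 ≤ r → 0 < s → χla≡ (DF3 r s) 3
DF3-χla≡3 {r} {s} 2≤r 0<s = kindMerge-χla≡3 merge3-merges 0<r 0<s
  (<⇒≢ c<d) (m<n⇒m≢o*n (<-≤-trans (<-trans c<d d<e) (m≤n*m _ s ⦃ >-nonZero 0<s ⦄)) 0<r)
  (m<n⇒m≢o*n (<-≤-trans d<e (m≤n*m _ s ⦃ >-nonZero 0<s ⦄)) 0<r)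
  λ { end → trans (*-identityˡ _) (*-identityˡ _) ; middle → trans (*-identityˡ _) (*-identityˡ _) ; apical → refl }
  where
  n = r * s
  0<r = <-trans z<s 2≤r
  c<d = end<middle (0<m*n 0<r 0<s)
  d<e = middle<apical n

DF4-χla≡3 : ∀ {r s} → 2 ≤ r → 0 < s → 2 ∣ r → χla≡ (DF4 r s) 3
DF4-χla≡3 {r} 2≤r 0<s (divides t r≡t*2) = cyclic-χla≡3 (trans r≡t*2 (t*2≡t+t t)) 0<t 0<s
  where
  t*2≡t+t : ∀ t → t * 2 ≡ t + t
  t*2≡t+t = solve-∀
  0<t : 0 < t
  0<t = n≢0⇒n>0 λ { refl → contradiction (subst (2 ≤_) r≡t*2 2≤r) λ () }

theorem2p10 : ∀ (r s : ℕ) → 2 ≤ r → 1 ≤ s →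
    ((2 ∣ s) → ¬ (4 ∣ r * s) → χla≡ (DF1 r s) 3)
    × ((2 ∣ s) → ¬ (4 ∣ r) → χla≡ (DF2 r s) 3)
    × χla≡ (DF3 r s) 3
    × ((2 ∣ r) → χla≡ (DF4 r s) 3)
theorem2p10 r s 2≤r 1≤s =
  DF1-χla≡3 2≤r 1≤s , DF2-χla≡3 2≤r 1≤s , DF3-χla≡3 2≤r 1≤s , DF4-χla≡3 2≤r 1≤s
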